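{- For every nonnegative integer $n$, the bistatistic $(\mathrm{asc}, \mathrm{rlm})$ has the same distribution over $\mathcal{A}_n(021)$ and over $S_n(132)$; that is, for all nonnegative integers $a$ and $r$, $$\#\{x\in\mathcal{A}_n(021) : \mathrm{asc}(x)=a,\ \mathrm{rlm}(x)=r\} = \#\{\pi\in S_n(132) : \mathrm{asc}(\pi)=a,\ \mathrm{rlm}(\pi)=r\}.$$
   Context: For a sequence $x=x_1x_2\ldots x_n$ of nonnegative integers (or a permutation written in one-line notation), an index $i$ with $1\le i<n$ is an ascent if $x_i<x_{i+1}$; $\mathrm{asc}(x)$ denotes the number of ascents of $x$ (with $\mathrm{asc}$ of a sequence of length at most $1$ equal to $0$). An index $i$ is a right-to-left minimum of $x$ if $x_i<x_j$ for all $j>i$; $\mathrm{rlm}(x)$ denotes the number of right-to-left minima. An ascent sequence of length $n$ is a sequence $x_1x_2\ldots x_n$ of nonnegative integers with $x_1=0$ and $x_i\le \mathrm{asc}(x_1x_2\ldots x_{i-1})+1$ for all $1<i\le n$; $\mathcal{A}_n$ denotes the set of ascent sequences of length $n$ (with $\mathcal{A}_0$ consisting of the empty sequence). A sequence $x$ contains the pattern $021$ if there are indices $i<j<k$ with $x_i<x_k<x_j$; $\mathcal{A}_n(021)$ is the set of ascent sequences of length $n$ not containing $021$. $S_n$ is the set of permutations of $\{1,\ldots,n\}$, and $S_n(132)$ is the set of $\pi\in S_n$ having no indices $i<j<k$ with $\pi_i<\pi_k<\pi_j$. -}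

module Defs where

open import Data.Nat using (ℕ; zero; suc; _+_; _<ᵇ_; _≡ᵇ_)
open import Data.Bool using (Bool; true; false; _∧_; _∨_; not; T)
open import Data.List using (List; []; _∷_; length; reverse)
open import Data.Product using (Σ; _×_)
open import Relation.Binary.PropositionalEquality using (_≡_)

-- Sequences (and permutations in one-line notation) are lists of naturals.

asc : List ℕ → ℕ
asc []           = 0
asc (_ ∷ [])     = 0
asc (a ∷ b ∷ xs) = (if' (a <ᵇ b)) + asc (b ∷ xs)
  where
  if' : Bool → ℕ
  if' true  = 1
  if' false = 0

allGreater : ℕ → List ℕ → Bool
allGreater a []       = true
allGreater a (b ∷ xs) = (a <ᵇ b) ∧ allGreater a xs

rlm : List ℕ → ℕ
rlm []       = 0
rlm (a ∷ xs) = (if' (allGreater a xs)) + rlm xs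
  where
  if' : Bool → ℕ
  if' true  = 1
  if' false = 0

-- Ascent sequence check, processing left to right.
-- ascSeqFrom prev k xs : the prefix so far ends in prev and has k ascents.
ascSeqFrom : ℕ → ℕ → List ℕ → Bool
ascSeqFrom prev k []       = true
ascSeqFrom prev k (x ∷ xs) =
  (x <ᵇ suc (suc k)) ∧ ascSeqFrom x (if' (prev <ᵇ x)) xs
  where
  if' : Bool → ℕ
  if' true  = suc k
  if' false = k

-- x_1 = 0 and x_i ≤ asc(x_1 … x_{i-1}) + 1 for 1 < i ≤ n; empty sequence allowed
isAscentSeq : List ℕ → Bool
isAscentSeq []       = true
isAscentSeq (x ∷ xs) = (x ≡ᵇ 0) ∧ ascSeqFrom x 0 xs

-- contains a pattern x_i < x_k < x_j with i < j < k
-- existsLater a b xs : some element c of xs with a < c < b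
existsBetween : ℕ → ℕ → List ℕ → Bool
existsBetween a b []       = false
existsBetween a b (c ∷ xs) = ((a <ᵇ c) ∧ (c <ᵇ b)) ∨ existsBetween a b xs

-- with x_i = a fixed, look for j < k in xs with a < x_k < x_j
contains021From : ℕ → List ℕ → Bool
contains021From a []       = false
contains021From a (b ∷ xs) = existsBetween a b xs ∨ contains021From a xs

contains021 : List ℕ → Bool
contains021 []       = false
contains021 (a ∷ xs) = contains021From a xs ∨ contains021 xs

-- (the pattern 132 for permutations is the same relative-order condition
--  π_i < π_k < π_j, so it is tested by the same function)
contains132 : List ℕ → Bool
contains132 = contains021

member : ℕ → List ℕ → Bool
member a []       = false
member a (b ∷ xs) = (a ≡ᵇ b) ∨ member a xs

noDup : List ℕ → Bool
noDup []       = true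
noDup (a ∷ xs) = not (member a xs) ∧ noDup xs

inRange : ℕ → List ℕ → Bool
inRange n []       = true
inRange n (a ∷ xs) = (0 <ᵇ a) ∧ (a <ᵇ suc n) ∧ inRange n xs

isPerm : ℕ → List ℕ → Bool
isPerm n π = (length π ≡ᵇ n) ∧ inRange n π ∧ noDup π

AscSet : ℕ → ℕ → ℕ → Set
AscSet n a r = Σ (List ℕ) λ x →
  T (isAscentSeq x) × length x ≡ n × T (not (contains021 x)) × asc x ≡ a × rlm x ≡ r

PermSet : ℕ → ℕ → ℕ → Set
PermSet n a r = Σ (List ℕ) λ π →
  T (isPerm n π) × T (not (contains132 π)) × asc π ≡ a × rlm π ≡ r

module Submission where

-- Writing S n a r for the objects of length n with
-- asc = a and rlm = r, both families obey the same generating-tree recursion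
--   S (n+2) a r'  ≅  Σ_{r ≥ r' ≥ 1} S (n+1) a r   ⊎   S (n+1) (a-1) (r'-1):
-- an object with rlm = r has r children keeping asc (with rlm = 1, …, r) and one
-- child increasing both statistics.  With equal base cases n = 0, 1 this yields
-- explicit bijections by induction ('equinumerous-by-recursion').
-- Permutations ('permStep'): shift σ up and insert a new minimum 1 in front of a
-- suffix of its final increasing run, whose length is rlm σ.
-- Ascent sequences ('ascStep'): insert a 0 right after a right-to-left minimum
-- ('insertZero'), or rewrite the last run of zeros ('raise'); the inverses
-- 'deleteLastZero' and 'lower' are chosen by whether the last 0 follows a
-- right-to-left minimum.

open import Defs
open import Data.Nat using (ℕ; zero; suc; pred; _+_; _∸_; _≤_; _<_; z≤n; s≤s; _<ᵇ_; _≡ᵇ_; _≤ᵇ_)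
open import Data.Nat.Properties
open import Data.Bool using (Bool; true; false; _∧_; _∨_; not; T; if_then_else_)
open import Data.Bool.Properties using (∨-identityʳ; ∧-identityʳ; ∨-zeroʳ; ∧-zeroʳ;
    not-involutive; T-irrelevant)
open import Data.List using (List; []; _∷_; length; map; drop)
open import Data.List.Properties using (length-map)
open import Data.Product using (Σ; _×_; _,_; proj₁; proj₂)
open import Data.Sum using (_⊎_; inj₁; inj₂)
open import Data.Empty using (⊥; ⊥-elim)
open import Data.Unit using (tt)
open import Relation.Nullary using (Dec; yes; no)
open import Relation.Binary.PropositionalEquality
open import Function.Bundles using (_⤖_; _↔_; Inverse; mk↔ₛ′)
open import Function.Properties.Inverse using (↔⇒⤖; ↔-sym; ↔-trans)

-- Statistic families indexed by length, number of ascents and number of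
-- right-to-left minima.
Family : Set₁
Family = ℕ → ℕ → ℕ → Set

-- The children of the objects of length n+1 with asc = a, labelled by the
-- statistics (a , r') they will have: either an object with rlm r ≥ r' ≥ 1 and
-- the same asc, or an object whose asc and rlm are one smaller.
Children : Family → ℕ → ℕ → ℕ → Set
Children S n a r' = (Σ ℕ λ r → ((1 ≤ r') × (r' ≤ r)) × S (suc n) a r)
                  ⊎ (Σ ℕ λ a₀ → Σ ℕ λ r₀ → ((a ≡ suc a₀) × (r' ≡ suc r₀)) × S (suc n) a₀ r₀)

Children-cong : ∀ {S S' : Family} n → (∀ a r → S (suc n) a r ↔ S' (suc n) a r) →
                ∀ a r → Children S n a r ↔ Children S' n a r
Children-cong {S} {S'} n f a r' = mk↔ₛ′ to from to∘from from∘to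
  where
  to : Children S n a r' → Children S' n a r'
  to (inj₁ (r , h , s))         = inj₁ (r , h , Inverse.to (f a r) s)
  to (inj₂ (a₀ , r₀ , h , s))   = inj₂ (a₀ , r₀ , h , Inverse.to (f a₀ r₀) s)
  from : Children S' n a r' → Children S n a r'
  from (inj₁ (r , h , s))       = inj₁ (r , h , Inverse.from (f a r) s)
  from (inj₂ (a₀ , r₀ , h , s)) = inj₂ (a₀ , r₀ , h , Inverse.from (f a₀ r₀) s)
  to∘from : ∀ y → to (from y) ≡ y
  to∘from (inj₁ (r , h , s)) = cong (λ z → inj₁ (r , h , z)) (Inverse.strictlyInverseˡ (f a r) s)
  to∘from (inj₂ (a₀ , r₀ , h , s)) = cong (λ z → inj₂ (a₀ , r₀ , h , z))
      (Inverse.strictlyInverseˡ (f a₀ r₀) s)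
  from∘to : ∀ y → from (to y) ≡ y
  from∘to (inj₁ (r , h , s)) = cong (λ z → inj₁ (r , h , z)) (Inverse.strictlyInverseʳ (f a r) s)
  from∘to (inj₂ (a₀ , r₀ , h , s)) = cong (λ z → inj₂ (a₀ , r₀ , h , z))
      (Inverse.strictlyInverseʳ (f a₀ r₀) s)

equinumerous-by-recursion : (S S' : Family) →
  (∀ a r → S 0 a r ↔ S' 0 a r) → (∀ a r → S 1 a r ↔ S' 1 a r) →
  (∀ n a r → S (suc (suc n)) a r ↔ Children S n a r) →
  (∀ n a r → S' (suc (suc n)) a r ↔ Children S' n a r) →
  ∀ n a r → S n a r ↔ S' n a r
equinumerous-by-recursion S S' b₀ b₁ rec rec' zero = b₀
equinumerous-by-recursion S S' b₀ b₁ rec rec' (suc zero) = b₁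
equinumerous-by-recursion S S' b₀ b₁ rec rec' (suc (suc n)) a r =
  ↔-trans (rec n a r)
    (↔-trans (Children-cong {S} {S'} n (equinumerous-by-recursion S S' b₀ b₁ rec rec' (suc n)) a r)
             (↔-sym (rec' n a r)))

module ChildrenEquality {S : Family} (list : ∀ {n a r} → S n a r → List ℕ)
         (list-injective : ∀ {n a r} (u v : S n a r) → list u ≡ list v → u ≡ v) where

  same-keep : ∀ {n a r'} {r₁ r₂} {h₁ : (1 ≤ r') × (r' ≤ r₁)} {h₂ : (1 ≤ r') × (r' ≤ r₂)}
              {s₁ : S (suc n) a r₁} {s₂ : S (suc n) a r₂} →
              r₁ ≡ r₂ → list s₁ ≡ list s₂ →
              _≡_ {A = Children S n a r'} (inj₁ (r₁ , h₁ , s₁)) (inj₁ (r₂ , h₂ , s₂))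
  same-keep {h₁ = p₁ , p₂} {h₂ = q₁ , q₂} {s₁} {s₂} refl e =
    cong₂ (λ u v → inj₁ (_ , u , v)) (cong₂ _,_ (≤-irrelevant p₁ q₁) (≤-irrelevant p₂ q₂))
        (list-injective s₁ s₂ e)

  same-grow : ∀ {n a r'} {a₁ a₂ r₁ r₂} {h₁ : (a ≡ suc a₁) × (r' ≡ suc r₁)} {h₂ : (a ≡ suc a₂) × (r' ≡ suc r₂)}
              {s₁ : S (suc n) a₁ r₁} {s₂ : S (suc n) a₂ r₂} →
              a₁ ≡ a₂ → r₁ ≡ r₂ → list s₁ ≡ list s₂ →
              _≡_ {A = Children S n a r'} (inj₂ (a₁ , r₁ , h₁ , s₁)) (inj₂ (a₂ , r₂ , h₂ , s₂))
  same-grow {h₁ = p₁ , p₂} {h₂ = q₁ , q₂} {s₁} {s₂} refl refl e =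
    cong₂ (λ u v → inj₂ (_ , _ , u , v)) (cong₂ _,_ (≡-irrelevant p₁ q₁) (≡-irrelevant p₂ q₂))
        (list-injective s₁ s₂ e)

-- A child with label r' ≥ 1 is produced with insertion parameter pred r'; the
-- following label arithmetic is shared by both generating trees.
suc-pred-≥1 : ∀ {r} → 1 ≤ r → suc (pred r) ≡ r
suc-pred-≥1 (s≤s _) = refl

keep-parameter : ∀ {r' r ρ} → 1 ≤ r' → r' ≤ r → ρ ≡ r → pred r' < ρ
keep-parameter h1 h2 refl = subst (_≤ _) (sym (suc-pred-≥1 h1)) h2

grow-parameter : ∀ {r' r₀ ρ} → r' ≡ suc r₀ → ρ ≡ r₀ → pred r' ≡ ρ
grow-parameter refl refl = refl

-- Defs phrases every property as a Boolean test.  We reason with equations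
-- b ≡ true / b ≡ false; the following lemmas translate between the tests and
-- the corresponding propositions.

bit : Bool → ℕ
bit true = 1
bit false = 0

true≢false : true ≡ false → ⊥
true≢false ()

∧-true : ∀ {x y} → x ∧ y ≡ true → (x ≡ true) × (y ≡ true)
∧-true {true} {true} _ = refl , refl
∧-true {true} {false} ()
∧-true {false} ()

∨-false : ∀ {x y} → x ∨ y ≡ false → (x ≡ false) × (y ≡ false)
∨-false {false} {false} _ = refl , refl
∨-false {true} ()
∨-false {false} {true} ()

not-false : ∀ {b} → not b ≡ false → b ≡ true
not-false {true} _ = refl

∨-swap : ∀ a b c → a ∨ (b ∨ c) ≡ b ∨ (a ∨ c)
∨-swap true true c = refl
∨-swap true false c = refl
∨-swap false b c = refl

T→ : ∀ {b} → T b → b ≡ true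
T→ {true} _ = refl

→T : ∀ {b} → b ≡ true → T b
→T refl = tt

Tn→ : ∀ {b} → T (not b) → b ≡ false
Tn→ {false} _ = refl

→Tn : ∀ {b} → b ≡ false → T (not b)
→Tn refl = tt

<ᵇ→ : ∀ {m n} → (m <ᵇ n) ≡ true → m < n
<ᵇ→ {m} {n} e = <ᵇ⇒< m n (→T e)

→<ᵇ : ∀ {m n} → m < n → (m <ᵇ n) ≡ true
→<ᵇ p = T→ (<⇒<ᵇ p)

<ᵇf→ : ∀ {m n} → (m <ᵇ n) ≡ false → n ≤ m
<ᵇf→ {m} {n} e = ≮⇒≥ (λ p → true≢false (trans (sym (→<ᵇ p)) e))

→<ᵇf : ∀ {m n} → n ≤ m → (m <ᵇ n) ≡ false
→<ᵇf {m} {n} p with m <ᵇ n in eq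
... | true = ⊥-elim (<⇒≱ (<ᵇ→ eq) p)
... | false = refl

n<ᵇn : ∀ n → (n <ᵇ n) ≡ false
n<ᵇn n = →<ᵇf {n} {n} ≤-refl

≤ᵇ→ : ∀ {m n} → (m ≤ᵇ n) ≡ true → m ≤ n
≤ᵇ→ {m} {n} e = ≤ᵇ⇒≤ m n (→T e)

→≤ᵇ : ∀ {m n} → m ≤ n → (m ≤ᵇ n) ≡ true
→≤ᵇ p = T→ (≤⇒≤ᵇ p)

≤ᵇf→ : ∀ {m n} → (m ≤ᵇ n) ≡ false → n < m
≤ᵇf→ {m} {n} e = ≰⇒> (λ le → true≢false (trans (sym (→≤ᵇ le)) e))

→≤ᵇf : ∀ {m n} → n < m → (m ≤ᵇ n) ≡ false
→≤ᵇf {m} {n} lt with m ≤ᵇ n in e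
... | true = ⊥-elim (<⇒≱ lt (≤ᵇ→ e))
... | false = refl

≤ᵇ≡not<ᵇ : ∀ m n → (m ≤ᵇ n) ≡ not (n <ᵇ m)
≤ᵇ≡not<ᵇ m n with n <ᵇ m in e
... | true = →≤ᵇf {m} {n} (<ᵇ→ e)
... | false = →≤ᵇ (<ᵇf→ {n} {m} e)

<ᵇ-flip : ∀ y z → y ≢ z → (z <ᵇ y) ≡ not (y <ᵇ z)
<ᵇ-flip y z ne with y <ᵇ z in e1 | z <ᵇ y in e2
... | true | true = ⊥-elim (<-asym (<ᵇ→ {y} {z} e1) (<ᵇ→ {z} {y} e2))
... | true | false = refl
... | false | true = refl
... | false | false = ⊥-elim (ne (≤-antisym (<ᵇf→ {z} {y} e2) (<ᵇf→ {y} {z} e1)))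

pred-<ᵇ : ∀ a b → 0 < a → 0 < b → (pred a <ᵇ pred b) ≡ (a <ᵇ b)
pred-<ᵇ (suc a) (suc b) _ _ = refl

≡ᵇ→ : ∀ {m n} → (m ≡ᵇ n) ≡ true → m ≡ n
≡ᵇ→ {m} {n} e = ≡ᵇ⇒≡ m n (→T e)

→≡ᵇ : ∀ {m n} → m ≡ n → (m ≡ᵇ n) ≡ true
→≡ᵇ {m} {n} e = T→ (≡⇒≡ᵇ m n e)

→≡ᵇf : ∀ {m n} → m ≢ n → (m ≡ᵇ n) ≡ false
→≡ᵇf {m} {n} ne with m ≡ᵇ n in eq
... | true = ⊥-elim (ne (≡ᵇ→ eq))
... | false = refl

≡ᵇ-sym : ∀ m n → (m ≡ᵇ n) ≡ (n ≡ᵇ m)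
≡ᵇ-sym zero zero = refl
≡ᵇ-sym zero (suc n) = refl
≡ᵇ-sym (suc m) zero = refl
≡ᵇ-sym (suc m) (suc n) = ≡ᵇ-sym m n

asc-cons : ∀ a b xs → asc (a ∷ b ∷ xs) ≡ bit (a <ᵇ b) + asc (b ∷ xs)
asc-cons a b xs with a <ᵇ b
... | true = refl
... | false = refl

rlm-cons : ∀ a xs → rlm (a ∷ xs) ≡ bit (allGreater a xs) + rlm xs
rlm-cons a xs with allGreater a xs
... | true = refl
... | false = refl

-- Adding 1 to every entry ('map suc') preserves all relative comparisons, hence
-- every statistic and pattern test of Defs.
allGreater-shift : ∀ a xs → allGreater (suc a) (map suc xs) ≡ allGreater a xs
allGreater-shift a [] = refl
allGreater-shift a (x ∷ xs) = cong (λ z → (a <ᵇ x) ∧ z) (allGreater-shift a xs)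

asc-shift : ∀ xs → asc (map suc xs) ≡ asc xs
asc-shift [] = refl
asc-shift (x ∷ []) = refl
asc-shift (x ∷ y ∷ ys) = trans (asc-cons (suc x) (suc y) (map suc ys))
  (trans (cong (bit (x <ᵇ y) +_) (asc-shift (y ∷ ys))) (sym (asc-cons x y ys)))

rlm-shift : ∀ xs → rlm (map suc xs) ≡ rlm xs
rlm-shift [] = refl
rlm-shift (x ∷ xs) = trans (rlm-cons (suc x) (map suc xs))
  (trans (cong₂ (λ u v → bit u + v) (allGreater-shift x xs) (rlm-shift xs)) (sym (rlm-cons x xs)))

existsBetween-shift : ∀ a b xs → existsBetween (suc a) (suc b) (map suc xs) ≡ existsBetween a b xs
existsBetween-shift a b [] = refl
existsBetween-shift a b (x ∷ xs) = cong (((a <ᵇ x) ∧ (x <ᵇ b)) ∨_) (existsBetween-shift a b xs)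

contains021From-shift : ∀ a xs → contains021From (suc a) (map suc xs) ≡ contains021From a xs
contains021From-shift a [] = refl
contains021From-shift a (x ∷ xs) = cong₂ _∨_ (existsBetween-shift a x xs) (contains021From-shift a xs)

contains021-shift : ∀ xs → contains021 (map suc xs) ≡ contains021 xs
contains021-shift [] = refl
contains021-shift (x ∷ xs) = cong₂ _∨_ (contains021From-shift x xs) (contains021-shift xs)

member-shift : ∀ a xs → member (suc a) (map suc xs) ≡ member a xs
member-shift a [] = refl
member-shift a (x ∷ xs) = cong ((a ≡ᵇ x) ∨_) (member-shift a xs)

noDup-shift : ∀ xs → noDup (map suc xs) ≡ noDup xs
noDup-shift [] = refl
noDup-shift (x ∷ xs) = cong₂ (λ u v → not u ∧ v) (member-shift x xs) (noDup-shift xs)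

increasing : List ℕ → Bool
increasing [] = true
increasing (x ∷ []) = true
increasing (x ∷ y ∷ ys) = (x <ᵇ y) ∧ increasing (y ∷ ys)

finalRun : List ℕ → ℕ
finalRun [] = 0
finalRun (x ∷ xs) = if increasing (x ∷ xs) then suc (length xs) else finalRun xs

increasing-shift : ∀ xs → increasing (map suc xs) ≡ increasing xs
increasing-shift [] = refl
increasing-shift (x ∷ []) = refl
increasing-shift (x ∷ y ∷ ys) = cong (λ z → (x <ᵇ y) ∧ z) (increasing-shift (y ∷ ys))

finalRun-shift : ∀ xs → finalRun (map suc xs) ≡ finalRun xs
finalRun-shift [] = refl
finalRun-shift (x ∷ xs) rewrite increasing-shift (x ∷ xs) | length-map suc xs | finalRun-shift xs = refl

increasing-tail : ∀ x xs → increasing (x ∷ xs) ≡ true → increasing xs ≡ true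
increasing-tail x [] _ = refl
increasing-tail x (y ∷ ys) e = proj₂ (∧-true {x <ᵇ y} e)

allGreater-mono : ∀ {a b} xs → a ≤ b → allGreater b xs ≡ true → allGreater a xs ≡ true
allGreater-mono [] _ _ = refl
allGreater-mono {a} {b} (x ∷ xs) le e with ∧-true {b <ᵇ x} e
... | e1 , e2 = trans (cong (λ z → z ∧ allGreater a xs) (→<ᵇ {a} {x} (≤-<-trans le (<ᵇ→ e1))))
    (allGreater-mono xs le e2)

increasing⇒allGreater : ∀ x xs → increasing (x ∷ xs) ≡ true → allGreater x xs ≡ true
increasing⇒allGreater x [] _ = refl
increasing⇒allGreater x (y ∷ ys) e with ∧-true {x <ᵇ y} e
... | e1 , e2 rewrite e1 = allGreater-mono ys (<⇒≤ (<ᵇ→ e1)) (increasing⇒allGreater y ys e2)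

finalRun≤length : ∀ xs → finalRun xs ≤ length xs
finalRun≤length [] = z≤n
finalRun≤length (x ∷ xs) with increasing (x ∷ xs)
... | true = ≤-refl
... | false = m≤n⇒m≤1+n (finalRun≤length xs)

finalRun-increasing : ∀ xs → increasing xs ≡ true → finalRun xs ≡ length xs
finalRun-increasing [] _ = refl
finalRun-increasing (x ∷ xs) e rewrite e = refl

finalRun-full : ∀ xs → length xs ≤ finalRun xs → increasing xs ≡ true
finalRun-full [] _ = refl
finalRun-full (x ∷ xs) le with increasing (x ∷ xs) in eq
... | true = refl
... | false = ⊥-elim (<⇒≱ (s≤s (finalRun≤length xs)) le)

rlm-increasing : ∀ xs → increasing xs ≡ true → rlm xs ≡ length xs
rlm-increasing [] _ = refl
rlm-increasing (x ∷ xs) e rewrite rlm-cons x xs | increasing⇒allGreater x xs e =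
    cong suc (rlm-increasing xs (increasing-tail x xs e))

existsBetween-false : ∀ {a b c} xs → (existsBetween a b (c ∷ xs)) ≡ false → a < c → b ≤ c
existsBetween-false {a} {b} {c} xs e ac with ∨-false {(a <ᵇ c) ∧ (c <ᵇ b)} e
... | e1 , _ rewrite →<ᵇ ac = <ᵇf→ e1

member-false : ∀ {a b} xs → member a (b ∷ xs) ≡ false → a ≢ b
member-false {a} {b} xs e eq = true≢false (trans (sym (cong (_∨ member a xs) (→≡ᵇ eq))) e)

increasing-above : ∀ a xs → allGreater a xs ≡ true → contains021From a xs ≡ false → noDup xs ≡ true →
    increasing xs ≡ true
increasing-above a [] _ _ _ = refl
increasing-above a (b ∷ []) _ _ _ = refl
increasing-above a (b ∷ c ∷ zs) ag cf nd =
  let ag2 = proj₂ (∧-true {a <ᵇ b} ag) in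
  let cf1 = proj₁ (∨-false {existsBetween a b (c ∷ zs)} cf) in
  let cf2 = proj₂ (∨-false {existsBetween a b (c ∷ zs)} cf) in
  let nd1 = proj₁ (∧-true {not (member b (c ∷ zs))} nd) in
  let nd2 = proj₂ (∧-true {not (member b (c ∷ zs))} nd) in
  let ac = proj₁ (∧-true {a <ᵇ c} ag2) in
  let bc = existsBetween-false zs cf1 (<ᵇ→ ac) in
  let bnc = member-false {b} {c} zs (trans (sym (not-involutive _)) (cong not nd1)) in
  trans (cong (_∧ increasing (c ∷ zs)) (→<ᵇ (≤∧≢⇒< bc bnc))) (increasing-above a (c ∷ zs) ag2 cf2 nd2)

rlm≡finalRun : ∀ xs → noDup xs ≡ true → contains021 xs ≡ false → rlm xs ≡ finalRun xs
rlm≡finalRun [] _ _ = refl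
rlm≡finalRun (a ∷ xs) nd cf with ∧-true {not (member a xs)} nd | ∨-false {contains021From a xs} cf
... | nd1 , nd2 | cf1 , cf2 rewrite rlm-cons a xs with increasing (a ∷ xs) in eq
... | true rewrite increasing⇒allGreater a xs eq =
    cong suc (trans (rlm≡finalRun xs nd2 cf2) (finalRun-increasing xs (increasing-tail a xs eq)))
... | false with allGreater a xs in eq2
...   | false = rlm≡finalRun xs nd2 cf2
...   | true = ⊥-elim (true≢false (trans (sym (prepend-increasing xs eq2
    (increasing-above a xs eq2 cf1 nd2))) eq))
  where
  prepend-increasing : ∀ ys → allGreater a ys ≡ true → increasing ys ≡ true → increasing (a ∷ ys) ≡ true
  prepend-increasing [] _ _ = refl
  prepend-increasing (y ∷ ys) ag ic with ∧-true {a <ᵇ y} ag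
  ... | e1 , _ rewrite e1 = ic

-- Permutation side.  'insertOne p τ' inserts the entry 1 at position p (or at
-- the end if p ≥ length τ); every permutation is of this form with τ = π - {1}.
insertOne : ℕ → List ℕ → List ℕ
insertOne zero xs = 1 ∷ xs
insertOne (suc p) [] = 1 ∷ []
insertOne (suc p) (x ∷ xs) = x ∷ insertOne p xs

length-insertOne : ∀ p xs → length (insertOne p xs) ≡ suc (length xs)
length-insertOne zero xs = refl
length-insertOne (suc p) [] = refl
length-insertOne (suc p) (x ∷ xs) = cong suc (length-insertOne p xs)

existsBetween-below-one : ∀ a xs → existsBetween a 1 xs ≡ false
existsBetween-below-one a [] = refl
existsBetween-below-one a (zero ∷ xs) = existsBetween-below-one a xs
existsBetween-below-one a (suc c ∷ xs) rewrite ∧-zeroʳ (a <ᵇ suc c) = existsBetween-below-one a xs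

existsBetween-insertOne : ∀ a b p xs → existsBetween (suc a) b (insertOne p xs) ≡ existsBetween (suc a) b xs
existsBetween-insertOne a b zero xs = refl
existsBetween-insertOne a b (suc p) [] = refl
existsBetween-insertOne a b (suc p) (x ∷ xs) = cong (((suc a <ᵇ x) ∧ (x <ᵇ b)) ∨_)
    (existsBetween-insertOne a b p xs)

contains021From-insertOne : ∀ y p xs → contains021From (suc y) (insertOne p xs) ≡ contains021From (suc y) xs
contains021From-insertOne y zero xs = cong (_∨ contains021From (suc y) xs)
    (existsBetween-below-one (suc y) xs)
contains021From-insertOne y (suc p) [] = refl
contains021From-insertOne y (suc p) (x ∷ xs) = cong₂ _∨_ (existsBetween-insertOne y x p xs)
    (contains021From-insertOne y p xs)

existsBetween-none : ∀ a y z zs → allGreater z zs ≡ true → y ≤ z → existsBetween a y zs ≡ false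
existsBetween-none a y z [] _ _ = refl
existsBetween-none a y z (c ∷ cs) ag le
  rewrite →<ᵇf {c} {y} (≤-trans le (<⇒≤ (<ᵇ→ (proj₁ (∧-true {z <ᵇ c} ag)))))
        | ∧-zeroʳ (a <ᵇ c) = existsBetween-none a y z cs (proj₂ (∧-true {z <ᵇ c} ag)) le

existsBetween-one-increasing : ∀ y z zs → increasing (z ∷ zs) ≡ true → 1 < z →
    existsBetween 1 y (z ∷ zs) ≡ (z <ᵇ y)
existsBetween-one-increasing y z zs ic lt rewrite →<ᵇ lt with z <ᵇ y in e
... | true = refl
... | false = existsBetween-none 1 y z zs (increasing⇒allGreater z zs ic) (<ᵇf→ e)

contains021From-one-step : ∀ y z zs → allGreater 1 (y ∷ z ∷ zs) ≡ true → noDup (y ∷ z ∷ zs) ≡ true →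
      contains021From 1 (z ∷ zs) ≡ not (increasing (z ∷ zs)) →
      contains021From 1 (y ∷ z ∷ zs) ≡ not (increasing (y ∷ z ∷ zs))
contains021From-one-step y z zs ag nd ih with increasing (z ∷ zs) in eq
... | true =
  let ag2 = proj₂ (∧-true {1 <ᵇ y} ag) in
  let nd1 = proj₁ (∧-true {not (member y (z ∷ zs))} nd) in
  begin
    existsBetween 1 y (z ∷ zs) ∨ contains021From 1 (z ∷ zs)
  ≡⟨ cong₂ _∨_ (existsBetween-one-increasing y z zs eq (<ᵇ→ (proj₁ (∧-true {1 <ᵇ z} ag2)))) ih ⟩
    (z <ᵇ y) ∨ false
  ≡⟨ ∨-identityʳ _ ⟩
    (z <ᵇ y)
  ≡⟨ <ᵇ-flip y z (member-false {y} {z} zs (trans (sym (not-involutive _)) (cong not nd1))) ⟩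
    not (y <ᵇ z)
  ≡⟨ cong not (sym (∧-identityʳ _)) ⟩
    not ((y <ᵇ z) ∧ true)
  ∎
  where open ≡-Reasoning
... | false =
  trans (cong (existsBetween 1 y (z ∷ zs) ∨_) ih)
        (trans (∨-zeroʳ _) (cong not (sym (∧-zeroʳ (y <ᵇ z)))))

contains021From-one : ∀ τ → allGreater 1 τ ≡ true → noDup τ ≡ true → contains021From 1 τ ≡ not (increasing τ)
contains021From-one [] _ _ = refl
contains021From-one (y ∷ []) _ _ = refl
contains021From-one (y ∷ z ∷ zs) ag nd = contains021From-one-step y z zs ag nd
    (contains021From-one (z ∷ zs) (proj₂ (∧-true {1 <ᵇ y} ag)) (proj₂ (∧-true {not (member y (z ∷ zs))} nd)))

contains021-insertOne : ∀ p τ → allGreater 1 τ ≡ true → noDup τ ≡ true →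
          contains021 (insertOne p τ) ≡ not (increasing (drop p τ)) ∨ contains021 τ
contains021-insertOne zero τ ag nd = cong (_∨ contains021 τ) (contains021From-one τ ag nd)
contains021-insertOne (suc p) [] ag nd = refl
contains021-insertOne (suc p) (zero ∷ ys) () nd
contains021-insertOne (suc p) (suc zero ∷ ys) () nd
contains021-insertOne (suc p) (suc (suc y) ∷ ys) ag nd =
  trans (cong₂ _∨_ (contains021From-insertOne (suc y) p ys)
      (contains021-insertOne p ys (proj₂ (∧-true {1 <ᵇ suc (suc y)} ag))
      (proj₂ (∧-true {not (member (suc (suc y)) ys)} nd))))
        (∨-swap (contains021From (suc (suc y)) ys) (not (increasing (drop p ys))) (contains021 ys))

-- Entries in front of the inserted 1 are never right-to-left minima ...
allGreater-insertOne : ∀ y q zs → allGreater (suc y) (insertOne q zs) ≡ false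
allGreater-insertOne y zero zs = refl
allGreater-insertOne y (suc q) [] = refl
allGreater-insertOne y (suc q) (z ∷ zs) rewrite allGreater-insertOne y q zs = ∧-zeroʳ _

-- ... while the inserted 1 and the increasing suffix behind it all are.
rlm-insertOne : ∀ p τ → allGreater 1 τ ≡ true → increasing (drop p τ) ≡ true →
    rlm (insertOne p τ) ≡ suc (length τ ∸ p)
rlm-insertOne zero τ ag ic rewrite rlm-cons 1 τ | ag = cong suc (rlm-increasing τ ic)
rlm-insertOne (suc p) [] ag ic = refl
rlm-insertOne (suc p) (zero ∷ ys) () ic
rlm-insertOne (suc p) (suc y ∷ ys) ag ic rewrite rlm-cons (suc y) (insertOne p ys) |
    allGreater-insertOne y p ys =
  rlm-insertOne p ys (allGreater-mono ys (s≤s z≤n) (proj₂ (∧-true {1 <ᵇ suc y} ag))) ic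

finalRun-indicator-cons : ∀ y ys L → L < length ys → (L ≡ᵇ finalRun (y ∷ ys)) ≡ (L ≡ᵇ finalRun ys)
finalRun-indicator-cons y ys L lt with increasing (y ∷ ys) in e
... | true rewrite finalRun-increasing ys (increasing-tail y ys e) | →≡ᵇf (<⇒≢ lt) =
  →≡ᵇf (<⇒≢ (m<n⇒m<1+n lt))
... | false = refl

asc-insertOne-second : ∀ y z zs → 1 < z → increasing (z ∷ zs) ≡ true →
  asc (suc (suc y) ∷ 1 ∷ z ∷ zs) ≡ asc (suc (suc y) ∷ z ∷ zs) + bit
      (suc (length zs) ≡ᵇ finalRun (suc (suc y) ∷ z ∷ zs))
asc-insertOne-second y z zs 1<z ic
  rewrite asc-cons (suc (suc y)) 1 (z ∷ zs) | asc-cons 1 z zs | asc-cons (suc (suc y)) z zs | →<ᵇ 1<z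
  with suc (suc y) <ᵇ z
... | true rewrite ic | →≡ᵇf (<⇒≢ (n<1+n (length zs))) = sym (+-identityʳ _)
... | false rewrite ic | →≡ᵇ {length zs} refl = +-comm 1 _

asc-insertOne : ∀ p τ → 0 < length τ → allGreater 1 τ ≡ true → increasing (drop p τ) ≡ true →
                asc (insertOne p τ) ≡ asc τ + bit ((length τ ∸ p) ≡ᵇ finalRun τ)
asc-insertOne p (zero ∷ ys) _ () _
asc-insertOne p (suc zero ∷ ys) _ () _
asc-insertOne zero (suc (suc y) ∷ ys) _ _ ic
  rewrite finalRun-increasing (suc (suc y) ∷ ys) ic | →≡ᵇ {length ys} refl = +-comm 1 _
asc-insertOne (suc zero) (suc (suc y) ∷ []) _ _ _ = refl
asc-insertOne (suc (suc p)) (suc (suc y) ∷ []) _ _ _ = refl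
asc-insertOne (suc zero) (suc (suc y) ∷ z ∷ zs) _ ag ic =
  asc-insertOne-second y z zs (<ᵇ→ (proj₁ (∧-true {1 <ᵇ z} (proj₂ (∧-true {1 <ᵇ suc (suc y)} ag))))) ic
asc-insertOne (suc (suc p)) (suc (suc y) ∷ z ∷ zs) _ ag ic = begin
    asc (suc (suc y) ∷ z ∷ insertOne p zs)
  ≡⟨ asc-cons (suc (suc y)) z (insertOne p zs) ⟩
    b + asc (insertOne (suc p) (z ∷ zs))
  ≡⟨ cong (b +_) (asc-insertOne (suc p) (z ∷ zs) (s≤s z≤n) (proj₂ (∧-true {1 <ᵇ suc (suc y)} ag)) ic) ⟩
    b + (asc (z ∷ zs) + bit (L ≡ᵇ finalRun (z ∷ zs)))
  ≡⟨ sym (+-assoc b _ _) ⟩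
    b + asc (z ∷ zs) + bit (L ≡ᵇ finalRun (z ∷ zs))
  ≡⟨ cong₂ (λ u v → u + bit v) (sym (asc-cons (suc (suc y)) z zs))
           (sym (finalRun-indicator-cons (suc (suc y)) (z ∷ zs) L (s≤s (m∸n≤m (length zs) p)))) ⟩
    asc (suc (suc y) ∷ z ∷ zs) + bit (L ≡ᵇ finalRun (suc (suc y) ∷ z ∷ zs))
  ∎
  where
  open ≡-Reasoning
  b : ℕ
  b = bit (suc (suc y) <ᵇ z)
  L : ℕ
  L = length zs ∸ p

increasing-suffix⇒ : ∀ p τ → increasing (drop p τ) ≡ true → length τ ∸ p ≤ finalRun τ
increasing-suffix⇒ zero τ ic = ≤-reflexive (sym (finalRun-increasing τ ic))
increasing-suffix⇒ (suc p) [] ic = z≤n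
increasing-suffix⇒ (suc p) (y ∷ ys) ic with increasing (y ∷ ys) in e
... | true = ≤-trans (m∸n≤m (length ys) p) (n≤1+n _)
... | false = increasing-suffix⇒ p ys ic

increasing-suffix⇐ : ∀ p τ → length τ ∸ p ≤ finalRun τ → increasing (drop p τ) ≡ true
increasing-suffix⇐ zero τ le = finalRun-full τ le
increasing-suffix⇐ (suc p) [] le = refl
increasing-suffix⇐ (suc p) (y ∷ ys) le with increasing (y ∷ ys) in e
... | true = increasing-suffix⇐ p ys (subst (length ys ∸ p ≤_)
    (sym (finalRun-increasing ys (increasing-tail y ys e))) (m∸n≤m (length ys) p))
... | false = increasing-suffix⇐ p ys le

positionOfOne : List ℕ → ℕ
positionOfOne [] = 0
positionOfOne (x ∷ xs) = if 1 ≡ᵇ x then 0 else suc (positionOfOne xs)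

removeOne : List ℕ → List ℕ
removeOne [] = []
removeOne (x ∷ xs) = if 1 ≡ᵇ x then xs else x ∷ removeOne xs

insertOne-split : ∀ π → member 1 π ≡ true → insertOne (positionOfOne π) (removeOne π) ≡ π
insertOne-split (x ∷ xs) m with 1 ≡ᵇ x in e
... | true = cong (_∷ xs) (≡ᵇ→ e)
... | false = cong (x ∷_) (insertOne-split xs m)

positionOfOne≤ : ∀ π → positionOfOne π ≤ length (removeOne π)
positionOfOne≤ [] = z≤n
positionOfOne≤ (x ∷ xs) with 1 ≡ᵇ x
... | true = z≤n
... | false = s≤s (positionOfOne≤ xs)

positionOfOne-insertOne : ∀ p τ → p ≤ length τ → member 1 τ ≡ false → positionOfOne (insertOne p τ) ≡ p
positionOfOne-insertOne zero τ _ _ = refl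
positionOfOne-insertOne (suc p) (y ∷ ys) (s≤s le) m with 1 ≡ᵇ y
... | true = ⊥-elim (true≢false m)
... | false = cong suc (positionOfOne-insertOne p ys le m)

removeOne-insertOne : ∀ p τ → member 1 τ ≡ false → removeOne (insertOne p τ) ≡ τ
removeOne-insertOne zero τ _ = refl
removeOne-insertOne (suc p) [] _ = refl
removeOne-insertOne (suc p) (y ∷ ys) m with 1 ≡ᵇ y
... | true = ⊥-elim (true≢false m)
... | false = cong (y ∷_) (removeOne-insertOne p ys m)

member-insertOne : ∀ a p xs → member a (insertOne p xs) ≡ (a ≡ᵇ 1) ∨ member a xs
member-insertOne a zero xs = refl
member-insertOne a (suc p) [] = refl
member-insertOne a (suc p) (x ∷ xs) rewrite member-insertOne a p xs = ∨-swap (a ≡ᵇ x) (a ≡ᵇ 1) (member a xs)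

noDup-swap : ∀ a b c d → not (a ∨ b) ∧ (not c ∧ d) ≡ not (a ∨ c) ∧ (not b ∧ d)
noDup-swap true b c d = refl
noDup-swap false true true d = refl
noDup-swap false true false d = refl
noDup-swap false false true d = refl
noDup-swap false false false d = refl

noDup-insertOne : ∀ p xs → noDup (insertOne p xs) ≡ not (member 1 xs) ∧ noDup xs
noDup-insertOne zero xs = refl
noDup-insertOne (suc p) [] = refl
noDup-insertOne (suc p) (y ∷ ys) rewrite member-insertOne y p ys | noDup-insertOne p ys | ≡ᵇ-sym y 1 =
  noDup-swap (1 ≡ᵇ y) (member y ys) (member 1 ys) (noDup ys)

inRange-insertOne : ∀ k p xs → inRange (suc k) (insertOne p xs) ≡ inRange (suc k) xs
inRange-insertOne k zero xs = refl
inRange-insertOne k (suc p) [] = refl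
inRange-insertOne k (suc p) (x ∷ xs) = cong (λ z → (0 <ᵇ x) ∧ (x <ᵇ suc (suc k)) ∧ z)
    (inRange-insertOne k p xs)

inRange-shift : ∀ m σ → inRange m σ ≡ true → inRange (suc m) (map suc σ) ≡ true
inRange-shift m [] _ = refl
inRange-shift m (v ∷ vs) e with ∧-true {0 <ᵇ v} e
... | _ , e2 with ∧-true {v <ᵇ suc m} e2
... | e3 , e4 rewrite e3 = inRange-shift m vs e4

inRange-unshift : ∀ m σ → inRange (suc m) (map suc σ) ≡ true → allGreater 0 σ ≡ true → inRange m σ ≡ true
inRange-unshift m [] _ _ = refl
inRange-unshift m (v ∷ vs) e ag with ∧-true {v <ᵇ suc m} e | ∧-true {0 <ᵇ v} ag
... | e3 , e4 | a1 , a2 rewrite e3 | a1 = inRange-unshift m vs e4 a2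

inRange⇒positive : ∀ m σ → inRange m σ ≡ true → allGreater 0 σ ≡ true
inRange⇒positive m [] _ = refl
inRange⇒positive m (v ∷ vs) e with ∧-true {0 <ᵇ v} e
... | e1 , e2 rewrite e1 = inRange⇒positive m vs (proj₂ (∧-true {v <ᵇ suc m} e2))

shift-unshift : ∀ xs → allGreater 0 xs ≡ true → map suc (map pred xs) ≡ xs
shift-unshift [] _ = refl
shift-unshift (zero ∷ xs) ()
shift-unshift (suc x ∷ xs) e = cong (suc x ∷_) (shift-unshift xs e)

unshift-shift : ∀ xs → map pred (map suc xs) ≡ xs
unshift-shift [] = refl
unshift-shift (x ∷ xs) = cong (x ∷_) (unshift-shift xs)

allGreater-one : ∀ τ → allGreater 0 τ ≡ true → member 1 τ ≡ false → allGreater 1 τ ≡ true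
allGreater-one [] _ _ = refl
allGreater-one (zero ∷ xs) () _
allGreater-one (suc zero ∷ xs) _ ()
allGreater-one (suc (suc x) ∷ xs) a m = allGreater-one xs a m

member-zero : ∀ σ → allGreater 0 σ ≡ true → member 0 σ ≡ false
member-zero [] _ = refl
member-zero (zero ∷ xs) ()
member-zero (suc x ∷ xs) a = member-zero xs a

removeValue : ℕ → List ℕ → List ℕ
removeValue a [] = []
removeValue a (x ∷ xs) = if a ≡ᵇ x then xs else x ∷ removeValue a xs

length-removeValue : ∀ a xs → member a xs ≡ true → length xs ≡ suc (length (removeValue a xs))
length-removeValue a (x ∷ xs) m with a ≡ᵇ x
... | true = refl
... | false = cong suc (length-removeValue a xs m)

member-removeValue : ∀ b a xs → member b (removeValue a xs) ≡ true → member b xs ≡ true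
member-removeValue b a (x ∷ xs) m with a ≡ᵇ x
... | true rewrite m = ∨-zeroʳ (b ≡ᵇ x)
... | false with b ≡ᵇ x
...   | true = refl
...   | false = member-removeValue b a xs m

noDup-removeValue : ∀ a xs → noDup xs ≡ true → noDup (removeValue a xs) ≡ true
noDup-removeValue a [] _ = refl
noDup-removeValue a (x ∷ xs) nd with ∧-true {not (member x xs)} nd
... | n1 , n2 with a ≡ᵇ x
...   | true = n2
...   | false with member x (removeValue a xs) in e
...     | true = ⊥-elim (true≢false (trans (sym (member-removeValue x a xs e))
    (trans (sym (not-involutive _)) (cong not n1))))
...     | false = noDup-removeValue a xs n2

member-removeValue-self : ∀ a xs → noDup xs ≡ true → member a (removeValue a xs) ≡ false
member-removeValue-self a [] _ = refl
member-removeValue-self a (x ∷ xs) nd with ∧-true {not (member x xs)} nd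
... | n1 , n2 with a ≡ᵇ x in e
...   | true = subst (λ z → member z xs ≡ false) (sym (≡ᵇ→ e)) (trans (sym (not-involutive _)) (cong not n1))
...   | false rewrite e = member-removeValue-self a xs n2

inRange-removeValue : ∀ k a xs → inRange k xs ≡ true → inRange k (removeValue a xs) ≡ true
inRange-removeValue k a [] _ = refl
inRange-removeValue k a (x ∷ xs) e with a ≡ᵇ x
... | true = proj₂ (∧-true {x <ᵇ suc k} (proj₂ (∧-true {0 <ᵇ x} e)))
... | false with ∧-true {0 <ᵇ x} e
...   | e1 , e2 with ∧-true {x <ᵇ suc k} e2
...     | e3 , e4 rewrite e1 | e3 = inRange-removeValue k a xs e4

inRange-lower : ∀ k xs → inRange (suc k) xs ≡ true → member (suc k) xs ≡ false → inRange k xs ≡ true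
inRange-lower k [] _ _ = refl
inRange-lower k (x ∷ xs) e m with ∧-true {0 <ᵇ x} e | ∨-false {suc k ≡ᵇ x} m
... | e1 , e2 | m1 , m2 with ∧-true {x <ᵇ suc (suc k)} e2
... | e3 , e4 rewrite e1 | →<ᵇ {x} {suc k} (≤∧≢⇒< (≤-pred (<ᵇ→ e3))
    (λ eq → true≢false (trans (sym (→≡ᵇ (sym eq))) m1))) = inRange-lower k xs e4 m2

distinct-length : ∀ m xs → noDup xs ≡ true → inRange m xs ≡ true → length xs ≤ m
distinct-length zero [] _ _ = z≤n
distinct-length zero (zero ∷ xs) _ ()
distinct-length zero (suc x ∷ xs) _ ()
distinct-length (suc k) xs nd e with member (suc k) xs in mm
... | true = subst (_≤ suc k) (sym (length-removeValue (suc k) xs mm))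
               (s≤s (distinct-length k (removeValue (suc k) xs) (noDup-removeValue (suc k) xs nd)
                  (inRange-lower k (removeValue (suc k) xs) (inRange-removeValue (suc k) (suc k) xs e)
                      (member-removeValue-self (suc k) xs nd))))
... | false = m≤n⇒m≤1+n (distinct-length k xs nd (inRange-lower k xs e mm))

isPerm-parts : ∀ {k π} → T (isPerm k π) → (length π ≡ k) × (inRange k π ≡ true) × (noDup π ≡ true)
isPerm-parts {k} {π} t with ∧-true {length π ≡ᵇ k} (T→ t)
... | e1 , e2 with ∧-true {inRange k π} e2
... | e3 , e4 = ≡ᵇ→ e1 , e3 , e4

isPerm-intro : ∀ {k π} → length π ≡ k → inRange k π ≡ true → noDup π ≡ true → T (isPerm k π)
isPerm-intro {k} {π} e1 e2 e3 rewrite →≡ᵇ e1 | e2 | e3 = tt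

unshift-distinct : ∀ k τ → inRange (suc k) τ ≡ true → noDup τ ≡ true → member 1 τ ≡ false →
                   (map suc (map pred τ) ≡ τ) × (inRange k (map pred τ) ≡ true) × (noDup (map pred τ) ≡ true)
unshift-distinct k τ inR nd one∉ = shifted , inRange-unshift k σ
    (subst (λ z → inRange (suc k) z ≡ true) (sym shifted) inR) σ-positive ,
                                   trans (sym (noDup-shift σ)) (trans (cong noDup shifted) nd)
  where
  σ : List ℕ
  σ = map pred τ
  τ-positive : allGreater 0 τ ≡ true
  τ-positive = inRange⇒positive (suc k) τ inR
  shifted : map suc σ ≡ τ
  shifted = shift-unshift τ τ-positive
  σ-positive : allGreater 0 σ ≡ true
  σ-positive = trans (sym (allGreater-shift 0 σ)) (trans (cong (allGreater 1) shifted)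
      (allGreater-one τ τ-positive one∉))

one∈perm : ∀ k π → T (isPerm (suc k) π) → member 1 π ≡ true
one∈perm k π ip with isPerm-parts {suc k} {π} ip
... | len , inR , nd with member 1 π in one∉
... | true = refl
... | false with unshift-distinct k π inR nd one∉
... | _ , inRσ , ndσ =
  ⊥-elim (<⇒≱ (n<1+n k) (subst (_≤ k) (trans (length-map pred π) len)
      (distinct-length k (map pred π) ndσ inRσ)))

-- τ consists of m distinct entries from {2, …, m+1}: a permutation of
-- {1, …, m+1} with its entry 1 removed.
record Punctured (m : ℕ) (τ : List ℕ) : Set where
  field
    length≡ : length τ ≡ m
    inRange≡ : inRange (suc m) τ ≡ true
    noDup≡ : noDup τ ≡ true
    one∉ : member 1 τ ≡ false

puncture : ∀ m p τ → T (isPerm (suc m) (insertOne p τ)) → Punctured m τ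
puncture m p τ ip with isPerm-parts {suc m} {insertOne p τ} ip
... | len , inR , nd with ∧-true {not (member 1 τ)} (trans (sym (noDup-insertOne p τ)) nd)
... | one∉ , ndτ = record
  { length≡ = suc-injective (trans (sym (length-insertOne p τ)) len)
  ; inRange≡ = trans (sym (inRange-insertOne m p τ)) inR
  ; noDup≡ = ndτ
  ; one∉ = trans (sym (not-involutive _)) (cong not one∉) }

unpuncture : ∀ m p τ → Punctured m τ → T (isPerm (suc m) (insertOne p τ))
unpuncture m p τ P =
  isPerm-intro {suc m} {insertOne p τ} (trans (length-insertOne p τ) (cong suc length≡))
      (trans (inRange-insertOne m p τ) inRange≡)
               (trans (noDup-insertOne p τ) (cong₂ (λ u v → not u ∧ v) one∉ noDup≡))
  where open Punctured P

punctured⇒above-one : ∀ {m τ} → Punctured m τ → allGreater 1 τ ≡ true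
punctured⇒above-one {m} {τ} P = allGreater-one τ (inRange⇒positive (suc m) τ inRange≡) one∉
  where open Punctured P

shift-punctured : ∀ m σ → T (isPerm m σ) → Punctured m (map suc σ)
shift-punctured m σ ip with isPerm-parts {m} {σ} ip
... | len , inR , nd = record
  { length≡ = trans (length-map suc σ) len
  ; inRange≡ = inRange-shift m σ inR
  ; noDup≡ = trans (noDup-shift σ) nd
  ; one∉ = trans (member-shift 0 σ) (member-zero σ (inRange⇒positive m σ inR)) }

unshift-punctured : ∀ m τ → Punctured m τ → T (isPerm m (map pred τ)) × (map suc (map pred τ) ≡ τ)
unshift-punctured m τ P with unshift-distinct m τ (Punctured.inRange≡ P)
    (Punctured.noDup≡ P) (Punctured.one∉ P)
... | shifted , inRσ , ndσ = isPerm-intro {m} {map pred τ}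
    (trans (length-map pred τ) (Punctured.length≡ P)) inRσ ndσ , shifted

PermSet-≡ : ∀ {n a r} (u v : PermSet n a r) → proj₁ u ≡ proj₁ v → u ≡ v
PermSet-≡ (x , p1 , p3 , p4 , p5) (.x , q1 , q3 , q4 , q5) refl
  rewrite T-irrelevant p1 q1 | T-irrelevant p3 q3 | ≡-irrelevant p4 q4 | ≡-irrelevant p5 q5 = refl

-- A permutation π of length n+2 reduces to
-- σ = π - {1}, shifted down, and L = number of entries after the 1; then
-- rlm π = L+1, L ≤ rlm σ and asc π = asc σ + [L = rlm σ].
module PermStep (n : ℕ) where
  open ChildrenEquality {PermSet} proj₁ PermSet-≡

  m : ℕ
  m = suc n

  reduce : List ℕ → List ℕ
  reduce π = map pred (removeOne π)

  tailLength : List ℕ → ℕ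
  tailLength π = m ∸ positionOfOne π

  grow : List ℕ → ℕ → List ℕ
  grow σ L = insertOne (m ∸ L) (map suc σ)

  record Reduction (π : List ℕ) : Set where
    field
      isPerm-reduce : T (isPerm m (reduce π))
      avoids-reduce : contains021 (reduce π) ≡ false
      tailLength≤ : tailLength π ≤ rlm (reduce π)
      asc-reduce : asc π ≡ asc (reduce π) + bit (tailLength π ≡ᵇ rlm (reduce π))
      rlm-reduce : rlm π ≡ suc (tailLength π)
      grow-reduce : grow (reduce π) (tailLength π) ≡ π

  reduction : ∀ π → T (isPerm (suc m) π) → contains021 π ≡ false → Reduction π
  reduction π ip av = record
    { isPerm-reduce = proj₁ unshifted ; avoids-reduce = avσ ; tailLength≤ =
        subst₂ _≤_ dl frτ (increasing-suffix⇒ p τ icd)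
    ; asc-reduce = ascπ ; rlm-reduce = trans (cong rlm (sym split))
        (trans (rlm-insertOne p τ ag1τ icd) (cong suc dl))
    ; grow-reduce = trans (cong₂ insertOne (m∸[m∸n]≡n (subst (p ≤_) lenτ (positionOfOne≤ π))) eτ) split }
    where
    p : ℕ
    p = positionOfOne π
    τ : List ℕ
    τ = removeOne π
    σ : List ℕ
    σ = reduce π
    split : insertOne p τ ≡ π
    split = insertOne-split π (one∈perm m π ip)
    P : Punctured m τ
    P = puncture m p τ (subst (λ z → T (isPerm (suc m) z)) (sym split) ip)
    unshifted : T (isPerm m σ) × (map suc σ ≡ τ)
    unshifted = unshift-punctured m τ P
    eτ : map suc σ ≡ τ
    eτ = proj₂ unshifted
    lenτ : length τ ≡ m
    lenτ = Punctured.length≡ P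
    ag1τ : allGreater 1 τ ≡ true
    ag1τ = punctured⇒above-one P
    split-avoids : not (increasing (drop p τ)) ∨ contains021 τ ≡ false
    split-avoids = trans (sym (contains021-insertOne p τ ag1τ (Punctured.noDup≡ P)))
        (subst (λ z → contains021 z ≡ false) (sym split) av)
    icd : increasing (drop p τ) ≡ true
    icd = not-false (proj₁ (∨-false {not (increasing (drop p τ))} split-avoids))
    avσ : contains021 σ ≡ false
    avσ = trans (sym (contains021-shift σ)) (trans (cong contains021 eτ)
        (proj₂ (∨-false {not (increasing (drop p τ))} split-avoids)))
    frτ : finalRun τ ≡ rlm σ
    frτ = trans (cong finalRun (sym eτ)) (trans (finalRun-shift σ)
        (sym (rlm≡finalRun σ (proj₂ (proj₂ (isPerm-parts {m} {σ} (proj₁ unshifted)))) avσ)))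
    dl : length τ ∸ p ≡ tailLength π
    dl = cong (_∸ p) lenτ
    ascπ : asc π ≡ asc σ + bit (tailLength π ≡ᵇ rlm σ)
    ascπ = trans (cong asc (sym split))
            (trans (asc-insertOne p τ (subst (0 <_) (sym lenτ) (s≤s z≤n)) ag1τ icd)
             (cong₂ (λ u v → u + bit v) (trans (cong asc (sym eτ)) (asc-shift σ)) (cong₂ _≡ᵇ_ dl frτ)))

  record Growth (σ : List ℕ) (L : ℕ) : Set where
    field
      isPerm-grow : T (isPerm (suc m) (grow σ L))
      avoids-grow : contains021 (grow σ L) ≡ false
      asc-grow : asc (grow σ L) ≡ asc σ + bit (L ≡ᵇ rlm σ)
      rlm-grow : rlm (grow σ L) ≡ suc L
      reduce-grow : reduce (grow σ L) ≡ σ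
      tailLength-grow : tailLength (grow σ L) ≡ L

  growth : ∀ σ L → T (isPerm m σ) → contains021 σ ≡ false → L ≤ rlm σ → Growth σ L
  growth σ L ipσ avσ Lle = record
    { isPerm-grow = unpuncture m p τ P
    ; avoids-grow = trans (contains021-insertOne p τ ag1τ (Punctured.noDup≡ P))
                          (cong₂ (λ u v → not u ∨ v) icd (trans (contains021-shift σ) avσ))
    ; asc-grow = trans (asc-insertOne p τ (subst (0 <_) (sym lenτ) (s≤s z≤n)) ag1τ icd)
                       (cong₂ (λ u v → u + bit v) (asc-shift σ) (cong₂ _≡ᵇ_ dL frτσ))
    ; rlm-grow = trans (rlm-insertOne p τ ag1τ icd) (cong suc dL)
    ; reduce-grow = trans (cong (map pred) (removeOne-insertOne p τ (Punctured.one∉ P))) (unshift-shift σ)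
    ; tailLength-grow = trans (cong (m ∸_) (positionOfOne-insertOne p τ (subst (p ≤_) (sym lenτ) (m∸n≤m m L))
        (Punctured.one∉ P)))
                              (m∸[m∸n]≡n Lm) }
    where
    τ : List ℕ
    τ = map suc σ
    p : ℕ
    p = m ∸ L
    P : Punctured m τ
    P = shift-punctured m σ ipσ
    ag1τ : allGreater 1 τ ≡ true
    ag1τ = punctured⇒above-one P
    lenτ : length τ ≡ m
    lenτ = Punctured.length≡ P
    Rσ : rlm σ ≡ finalRun σ
    Rσ = rlm≡finalRun σ (trans (sym (noDup-shift σ)) (Punctured.noDup≡ P)) avσ
    Lm : L ≤ m
    Lm = ≤-trans Lle (subst (_≤ m) (sym Rσ) (subst (finalRun σ ≤_) (trans (sym (length-map suc σ)) lenτ)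
        (finalRun≤length σ)))
    frτσ : finalRun τ ≡ rlm σ
    frτσ = trans (finalRun-shift σ) (sym Rσ)
    dL : length τ ∸ p ≡ L
    dL = trans (cong (_∸ p) lenτ) (m∸[m∸n]≡n Lm)
    icd : increasing (drop p τ) ≡ true
    icd = increasing-suffix⇐ p τ (subst₂ _≤_ (sym dL) (sym frτσ) Lle)

  -- A permutation is the extra child iff its L equals rlm σ.
  downH : ∀ {a r'} (x : PermSet (suc m) a r') → Dec (tailLength (proj₁ x) ≡ rlm (reduce (proj₁ x))) →
      Children PermSet n a r'
  downH {a} {r'} (π , ip , av , ea , er) (yes eq) =
    inj₂ (asc (reduce π) , rlm (reduce π) ,
          (trans (sym ea) (trans asc-reduce (trans
              (cong (λ u → asc (reduce π) + bit u) (→≡ᵇ eq)) (+-comm _ 1))) ,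
           trans (sym er) (trans rlm-reduce (cong suc eq))) ,
          (reduce π , isPerm-reduce , →Tn avoids-reduce , refl , refl))
    where open Reduction (reduction π ip (Tn→ av))
  downH {a} {r'} (π , ip , av , ea , er) (no ne) =
    inj₁ (rlm (reduce π) ,
          (subst (1 ≤_) (sym r'eq) (s≤s z≤n) , subst (_≤ rlm (reduce π)) (sym r'eq) (≤∧≢⇒< tailLength≤ ne)) ,
          (reduce π , isPerm-reduce , →Tn avoids-reduce ,
           trans (sym (+-identityʳ _)) (trans (cong (λ u → asc (reduce π) + bit u) (sym (→≡ᵇf ne)))
               (trans (sym asc-reduce) ea)) ,
           refl))
    where
    open Reduction (reduction π ip (Tn→ av))
    r'eq : r' ≡ suc (tailLength π)
    r'eq = trans (sym er) rlm-reduce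

  down : ∀ {a r'} → PermSet (suc m) a r' → Children PermSet n a r'
  down x = downH x (tailLength (proj₁ x) ≟ rlm (reduce (proj₁ x)))

  up : ∀ {a r'} → Children PermSet n a r' → PermSet (suc m) a r'
  up {a} {r'} (inj₁ (r , (h1 , h2) , (σ , ipσ , avT , ea , er))) =
    grow σ (pred r') , isPerm-grow , →Tn avoids-grow ,
    trans asc-grow (trans (cong (λ u → asc σ + bit u) (→≡ᵇf (<⇒≢ lt))) (trans (+-identityʳ _) ea)) ,
    trans rlm-grow (suc-pred-≥1 h1)
    where
    lt : pred r' < rlm σ
    lt = keep-parameter h1 h2 er
    open Growth (growth σ (pred r') ipσ (Tn→ avT) (<⇒≤ lt))
  up {a} {r'} (inj₂ (a₀ , r₀ , (ea' , er') , (σ , ipσ , avT , ea , er))) =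
    grow σ (pred r') , isPerm-grow , →Tn avoids-grow ,
    trans asc-grow (trans (cong (λ u → asc σ + bit u) (→≡ᵇ eqL))
        (trans (+-comm _ 1) (trans (cong suc ea) (sym ea')))) ,
    trans rlm-grow (trans (cong suc (cong pred er')) (sym er'))
    where
    eqL : pred r' ≡ rlm σ
    eqL = grow-parameter er' er
    open Growth (growth σ (pred r') ipσ (Tn→ avT) (≤-reflexive eqL))

  regrow : ∀ {a r'} (x : PermSet (suc m) a r') → grow (reduce (proj₁ x)) (pred r') ≡ proj₁ x
  regrow (π , ip , av , ea , er) =
    trans (cong (grow (reduce π)) (cong pred (trans (sym er) rlm-reduce))) grow-reduce
    where open Reduction (reduction π ip (Tn→ av))

  upDownH : ∀ {a r'} (x : PermSet (suc m) a r') d → up (downH x d) ≡ x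
  upDownH x (yes _) = PermSet-≡ _ _ (regrow x)
  upDownH x (no _) = PermSet-≡ _ _ (regrow x)

  downUpH : ∀ {a r'} (k : Children PermSet n a r') d → downH (up k) d ≡ k
  downUpH {a} {r'} (inj₁ (r , (h1 , h2) , (σ , ipσ , avT , ea , er))) d with growth σ (pred r') ipσ (Tn→ avT)
      (<⇒≤ (keep-parameter h1 h2 er))
  ... | U with d
  ... | yes eq = ⊥-elim (<⇒≢ (keep-parameter h1 h2 er)
      (trans (sym (Growth.tailLength-grow U)) (trans eq (cong rlm (Growth.reduce-grow U)))))
  ... | no _ = same-keep (trans (cong rlm (Growth.reduce-grow U)) er) (Growth.reduce-grow U)
  downUpH {a} {r'} (inj₂ (a₀ , r₀ , (ea' , er') , (σ , ipσ , avT , ea , er))) d with growth σ (pred r') ipσ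
      (Tn→ avT) (≤-reflexive (grow-parameter er' er))
  ... | U with d
  ... | yes _ = same-grow (trans (cong asc (Growth.reduce-grow U)) ea)
      (trans (cong rlm (Growth.reduce-grow U)) er) (Growth.reduce-grow U)
  ... | no ne = ⊥-elim (ne (trans (Growth.tailLength-grow U)
      (trans (grow-parameter er' er) (sym (cong rlm (Growth.reduce-grow U))))))

  step : ∀ a r' → PermSet (suc m) a r' ↔ Children PermSet n a r'
  step a r' = mk↔ₛ′ down up (λ k → downUpH k _) (λ x → upDownH x _)

permStep : ∀ n a r → PermSet (suc (suc n)) a r ↔ Children PermSet n a r
permStep n = PermStep.step n

ascSeqFrom-cons : ∀ p k x xs → ascSeqFrom p k (x ∷ xs) ≡ (x <ᵇ suc (suc k)) ∧ ascSeqFrom x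
    (bit (p <ᵇ x) + k) xs
ascSeqFrom-cons p k x xs with p <ᵇ x
... | true = refl
... | false = refl

ascFrom : ℕ → List ℕ → ℕ
ascFrom p [] = 0
ascFrom p (x ∷ xs) = bit (p <ᵇ x) + ascFrom x xs

asc≡ascFrom : ∀ x xs → asc (x ∷ xs) ≡ ascFrom x xs
asc≡ascFrom x [] = refl
asc≡ascFrom x (y ∷ ys) = trans (asc-cons x y ys) (cong (bit (x <ᵇ y) +_) (asc≡ascFrom y ys))

monotoneNonzero : ℕ → List ℕ → Bool
monotoneNonzero b [] = true
monotoneNonzero b (zero ∷ xs) = monotoneNonzero b xs
monotoneNonzero b (suc v ∷ xs) = (b ≤ᵇ suc v) ∧ monotoneNonzero (suc v) xs

zeroFree : List ℕ → Bool
zeroFree [] = true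
zeroFree (zero ∷ xs) = false
zeroFree (suc v ∷ xs) = zeroFree xs

zerosThenZeroFree : List ℕ → Bool
zerosThenZeroFree [] = true
zerosThenZeroFree (zero ∷ xs) = zerosThenZeroFree xs
zerosThenZeroFree (suc v ∷ xs) = zeroFree xs

existsBetween-0-0 : ∀ xs → existsBetween 0 0 xs ≡ false
existsBetween-0-0 [] = refl
existsBetween-0-0 (x ∷ xs) rewrite ∧-zeroʳ (0 <ᵇ x) = existsBetween-0-0 xs

existsBetween-widen : ∀ a b c xs → b ≤ c → existsBetween a b xs ≡ true → existsBetween a c xs ≡ true
existsBetween-widen a b c (x ∷ xs) le e with (a <ᵇ x) ∧ (x <ᵇ b) in e1
... | true with ∧-true {a <ᵇ x} e1
...   | e2 , e3 rewrite e2 | →<ᵇ {x} {c} (<-≤-trans (<ᵇ→ e3) le) = refl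
existsBetween-widen a b c (x ∷ xs) le e | false rewrite existsBetween-widen a b c xs le e = ∨-zeroʳ _

-- A 021-pattern with smallest value 0 is a descent among nonzero entries.
nonmonotone≡021 : ∀ b xs → not (monotoneNonzero b xs) ≡ existsBetween 0 b xs ∨ contains021From 0 xs
nonmonotone≡021 b [] = refl
nonmonotone≡021 b (zero ∷ xs) rewrite existsBetween-0-0 xs = nonmonotone≡021 b xs
nonmonotone≡021 b (suc v ∷ xs) rewrite ≤ᵇ≡not<ᵇ b (suc v) with suc v <ᵇ b in e
... | true = refl
... | false rewrite nonmonotone≡021 (suc v) xs with existsBetween 0 b xs in e2
...   | false = refl
...   | true rewrite existsBetween-widen 0 b (suc v) xs (<ᵇf→ e) e2 = refl

-- Any 021-pattern can be replaced by one whose smallest entry is a 0 in front.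
existsBetween-from-zero : ∀ a b xs → existsBetween a b xs ≡ true → existsBetween 0 b xs ≡ true
existsBetween-from-zero a b (x ∷ xs) e with (a <ᵇ x) ∧ (x <ᵇ b) in e1
... | true with ∧-true {a <ᵇ x} e1
...   | e2 , e3 rewrite e3 | →<ᵇ {0} {x} (≤-<-trans z≤n (<ᵇ→ e2)) = refl
existsBetween-from-zero a b (x ∷ xs) e | false rewrite existsBetween-from-zero a b xs e = ∨-zeroʳ _

contains021From-zero : ∀ a xs → contains021From a xs ≡ true → contains021From 0 xs ≡ true
contains021From-zero a (x ∷ xs) e with existsBetween a x xs in e1
... | true rewrite existsBetween-from-zero a x xs e1 = refl
... | false rewrite contains021From-zero a xs e = ∨-zeroʳ _

contains021⇒contains021From-zero : ∀ xs → contains021 xs ≡ true → contains021From 0 xs ≡ true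
contains021⇒contains021From-zero (x ∷ xs) e with contains021From x xs in e1
... | true = contains021From-zero x (x ∷ xs) (trans (cong (existsBetween x x xs ∨_) e1) (∨-zeroʳ _))
... | false rewrite contains021⇒contains021From-zero xs e = ∨-zeroʳ _

monotoneNonzero-0-1 : ∀ xs → monotoneNonzero 0 xs ≡ monotoneNonzero 1 xs
monotoneNonzero-0-1 [] = refl
monotoneNonzero-0-1 (zero ∷ xs) = monotoneNonzero-0-1 xs
monotoneNonzero-0-1 (suc v ∷ xs) = refl

contains021≡nonmonotone : ∀ xs → contains021 (0 ∷ xs) ≡ not (monotoneNonzero 1 (0 ∷ xs))
contains021≡nonmonotone xs with contains021 xs in e
... | true = trans (∨-zeroʳ _) (sym (trans (cong not (sym (monotoneNonzero-0-1 xs)))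
    (trans (nonmonotone≡021 0 xs) (trans (cong (_∨ contains021From 0 xs) (existsBetween-0-0 xs))
    (contains021⇒contains021From-zero xs e)))))
... | false = trans (∨-identityʳ _) (trans (sym (trans (nonmonotone≡021 0 xs)
    (cong (_∨ contains021From 0 xs) (existsBetween-0-0 xs)))) (cong not (monotoneNonzero-0-1 xs)))

-- First kind of child: insert a 0 right after the right-to-left minimum e whose
-- suffix has exactly d right-to-left minima.  The new 0 becomes the (d+1)-st
-- right-to-left minimum from the right, and every earlier one is lost.
insertZero : ℕ → List ℕ → List ℕ
insertZero d [] = []
insertZero d (e ∷ xs) = if allGreater e xs ∧ (rlm xs ≡ᵇ d) then e ∷ 0 ∷ xs else e ∷ insertZero d xs

deleteLastZero : List ℕ → List ℕ
deleteLastZero [] = []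
deleteLastZero (zero ∷ ys) = if zeroFree ys then ys else zero ∷ deleteLastZero ys
deleteLastZero (suc v ∷ ys) = suc v ∷ deleteLastZero ys

-- 'lastZeroAfterMin p x' tests whether the last 0 of x directly follows an
-- entry smaller than everything after that 0 (p is a dummy predecessor of the
-- first entry), i.e. whether x is a child of the first kind.
lastZeroAfterMin : ℕ → List ℕ → Bool
lastZeroAfterMin p [] = false
lastZeroAfterMin p (zero ∷ ys) = if zeroFree ys then allGreater p ys else lastZeroAfterMin 0 ys
lastZeroAfterMin p (suc v ∷ ys) = lastZeroAfterMin (suc v) ys

allGreater-not-zeroFree : ∀ a xs → zeroFree xs ≡ false → allGreater a xs ≡ false
allGreater-not-zeroFree a (zero ∷ xs) _ = refl
allGreater-not-zeroFree a (suc v ∷ xs) e rewrite allGreater-not-zeroFree a xs e = ∧-zeroʳ _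

zeroFree⇒positive : ∀ xs → zeroFree xs ≡ true → allGreater 0 xs ≡ true
zeroFree⇒positive [] _ = refl
zeroFree⇒positive (suc v ∷ xs) e = zeroFree⇒positive xs e

positive⇒zeroFree : ∀ xs → allGreater 0 xs ≡ true → zeroFree xs ≡ true
positive⇒zeroFree [] _ = refl
positive⇒zeroFree (suc v ∷ xs) e = positive⇒zeroFree xs e

rlm-cons-not-zeroFree : ∀ a xs → zeroFree xs ≡ false → rlm (a ∷ xs) ≡ rlm xs
rlm-cons-not-zeroFree a xs e rewrite rlm-cons a xs | allGreater-not-zeroFree a xs e = refl

insertZero-skip : ∀ d e xs → (allGreater e xs ∧ (rlm xs ≡ᵇ d)) ≡ false → d < rlm (e ∷ xs) → d < rlm xs
insertZero-skip d e xs c lt rewrite rlm-cons e xs with allGreater e xs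
... | false = lt
... | true = ≤∧≢⇒< (≤-pred lt) (λ eq → true≢false (trans (sym (→≡ᵇ (sym eq))) c))

insertZero-here : ∀ d e xs → (allGreater e xs ∧ (rlm xs ≡ᵇ d)) ≡ true →
    (allGreater e xs ≡ true) × (rlm xs ≡ d)
insertZero-here d e xs c = proj₁ (∧-true {allGreater e xs} c) , ≡ᵇ→ (proj₂ (∧-true {allGreater e xs} c))

insertZero-has-zero : ∀ d L → d < rlm L → zeroFree (insertZero d L) ≡ false
insertZero-has-zero d [] ()
insertZero-has-zero d (e ∷ xs) lt with allGreater e xs ∧ (rlm xs ≡ᵇ d) in c
insertZero-has-zero d (zero ∷ xs) lt | true = refl
insertZero-has-zero d (suc v ∷ xs) lt | true = refl
insertZero-has-zero d (zero ∷ xs) lt | false = refl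
insertZero-has-zero d (suc v ∷ xs) lt | false = insertZero-has-zero d xs (insertZero-skip d (suc v) xs c lt)

rlm-insertZero : ∀ d L → d < rlm L → rlm (insertZero d L) ≡ suc d
rlm-insertZero d [] ()
rlm-insertZero d (e ∷ xs) lt with allGreater e xs ∧ (rlm xs ≡ᵇ d) in c
... | true with insertZero-here d e xs c
...   | ag , eq rewrite rlm-cons e (0 ∷ xs) | rlm-cons 0 xs | allGreater-mono xs z≤n ag = cong suc eq
rlm-insertZero d (e ∷ xs) lt | false
  rewrite rlm-cons e (insertZero d xs) | allGreater-not-zeroFree e (insertZero d xs)
      (insertZero-has-zero d xs (insertZero-skip d e xs c lt)) =
      rlm-insertZero d xs (insertZero-skip d e xs c lt)

-- After an entry e below all later entries, the previous-entry parameter of the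
-- Boolean tests can be lowered to 0: no ascent changes.
ascSeqFrom-after-min : ∀ e k xs → allGreater e xs ≡ true → ascSeqFrom 0 k xs ≡ ascSeqFrom e k xs
ascSeqFrom-after-min e k [] _ = refl
ascSeqFrom-after-min e k (s ∷ xs) ag rewrite ascSeqFrom-cons 0 k s xs | ascSeqFrom-cons e k s xs
  | proj₁ (∧-true {e <ᵇ s} ag) | →<ᵇ {0} {s} (≤-<-trans z≤n (<ᵇ→ (proj₁ (∧-true {e <ᵇ s} ag)))) = refl

ascFrom-after-min : ∀ e xs → allGreater e xs ≡ true → ascFrom 0 xs ≡ ascFrom e xs
ascFrom-after-min e [] _ = refl
ascFrom-after-min e (s ∷ xs) ag
  rewrite proj₁ (∧-true {e <ᵇ s} ag) | →<ᵇ {0} {s} (≤-<-trans z≤n (<ᵇ→ (proj₁ (∧-true {e <ᵇ s} ag)))) = refl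

ascSeqFrom-insertZero : ∀ d L → d < rlm L → ∀ p k → ascSeqFrom p k (insertZero d L) ≡ ascSeqFrom p k L
ascSeqFrom-insertZero d [] ()
ascSeqFrom-insertZero d (e ∷ xs) lt p k with allGreater e xs ∧ (rlm xs ≡ᵇ d) in c
... | true rewrite ascSeqFrom-cons p k e (0 ∷ xs) | ascSeqFrom-cons p k e xs | ascSeqFrom-cons e
    (bit (p <ᵇ e) + k) 0 xs =
  cong ((e <ᵇ suc (suc k)) ∧_) (ascSeqFrom-after-min e _ xs (proj₁ (insertZero-here d e xs c)))
... | false rewrite ascSeqFrom-cons p k e (insertZero d xs) | ascSeqFrom-cons p k e xs =
  cong ((e <ᵇ suc (suc k)) ∧_) (ascSeqFrom-insertZero d xs (insertZero-skip d e xs c lt) e _)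

ascFrom-insertZero : ∀ d L → d < rlm L → ∀ p → ascFrom p (insertZero d L) ≡ ascFrom p L
ascFrom-insertZero d [] ()
ascFrom-insertZero d (e ∷ xs) lt p with allGreater e xs ∧ (rlm xs ≡ᵇ d) in c
... | true = cong (bit (p <ᵇ e) +_) (ascFrom-after-min e xs (proj₁ (insertZero-here d e xs c)))
... | false = cong (bit (p <ᵇ e) +_) (ascFrom-insertZero d xs (insertZero-skip d e xs c lt) e)

monotoneNonzero-insertZero : ∀ d L b → monotoneNonzero b (insertZero d L) ≡ monotoneNonzero b L
monotoneNonzero-insertZero d [] b = refl
monotoneNonzero-insertZero d (e ∷ xs) b with allGreater e xs ∧ (rlm xs ≡ᵇ d)
monotoneNonzero-insertZero d (zero ∷ xs) b | true = refl
monotoneNonzero-insertZero d (suc v ∷ xs) b | true = refl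
monotoneNonzero-insertZero d (zero ∷ xs) b | false = monotoneNonzero-insertZero d xs b
monotoneNonzero-insertZero d (suc v ∷ xs) b | false =
    cong ((b ≤ᵇ suc v) ∧_) (monotoneNonzero-insertZero d xs (suc v))

length-insertZero : ∀ d L → d < rlm L → length (insertZero d L) ≡ suc (length L)
length-insertZero d [] ()
length-insertZero d (e ∷ xs) lt with allGreater e xs ∧ (rlm xs ≡ᵇ d) in c
... | true = refl
... | false = cong suc (length-insertZero d xs (insertZero-skip d e xs c lt))

deleteLastZero-insertZero : ∀ d L → d < rlm L → deleteLastZero (insertZero d L) ≡ L
deleteLastZero-insertZero d [] ()
deleteLastZero-insertZero d (e ∷ xs) lt with allGreater e xs ∧ (rlm xs ≡ᵇ d) in c
deleteLastZero-insertZero d (zero ∷ xs) lt | true rewrite positive⇒zeroFree xs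
    (proj₁ (insertZero-here d zero xs c)) = refl
deleteLastZero-insertZero d (suc v ∷ xs) lt | true rewrite positive⇒zeroFree xs
    (allGreater-mono xs z≤n (proj₁ (insertZero-here d (suc v) xs c))) = refl
deleteLastZero-insertZero d (zero ∷ xs) lt | false rewrite insertZero-has-zero d xs
    (insertZero-skip d zero xs c lt) = cong (zero ∷_)
    (deleteLastZero-insertZero d xs (insertZero-skip d zero xs c lt))
deleteLastZero-insertZero d (suc v ∷ xs) lt | false =
    cong (suc v ∷_) (deleteLastZero-insertZero d xs (insertZero-skip d (suc v) xs c lt))

lastZeroAfterMin-insertZero : ∀ d L → d < rlm L → ∀ p → lastZeroAfterMin p (insertZero d L) ≡ true
lastZeroAfterMin-insertZero d [] ()
lastZeroAfterMin-insertZero d (e ∷ xs) lt p with allGreater e xs ∧ (rlm xs ≡ᵇ d) in c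
lastZeroAfterMin-insertZero d (zero ∷ xs) lt p | true rewrite positive⇒zeroFree xs
    (proj₁ (insertZero-here d zero xs c)) = proj₁ (insertZero-here d zero xs c)
lastZeroAfterMin-insertZero d (suc v ∷ xs) lt p | true rewrite positive⇒zeroFree xs
    (allGreater-mono xs z≤n (proj₁ (insertZero-here d (suc v) xs c))) = proj₁ (insertZero-here d (suc v) xs c)
lastZeroAfterMin-insertZero d (zero ∷ xs) lt p | false rewrite insertZero-has-zero d xs
    (insertZero-skip d zero xs c lt) = lastZeroAfterMin-insertZero d xs (insertZero-skip d zero xs c lt) 0
lastZeroAfterMin-insertZero d (suc v ∷ xs) lt p | false =
    lastZeroAfterMin-insertZero d xs (insertZero-skip d (suc v) xs c lt) (suc v)

insertZero-cons : ∀ y D L d → d < rlm D → insertZero d D ≡ L →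
    (d < rlm (y ∷ D)) × (insertZero d (y ∷ D) ≡ y ∷ L)
insertZero-cons y D L d lt eq with allGreater y D ∧ (rlm D ≡ᵇ d) in c
... | true = ⊥-elim (<⇒≢ lt (sym (proj₂ (insertZero-here d y D c))))
... | false = subst (d <_) (sym (rlm-cons y D)) (≤-trans lt (m≤n+m _ _)) , cong (y ∷_) eq

insertZero-deleteLastZero-from : ∀ y ys → zeroFree ys ≡ false → lastZeroAfterMin y ys ≡ true →
     (pred (rlm ys) < rlm (y ∷ deleteLastZero ys)) ×
         (insertZero (pred (rlm ys)) (y ∷ deleteLastZero ys) ≡ y ∷ ys)
insertZero-deleteLastZero-from y (zero ∷ zs) _ cl with zeroFree zs in ez
... | true rewrite rlm-cons 0 zs | zeroFree⇒positive zs ez | rlm-cons y zs | cl | →≡ᵇ {rlm zs}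
    refl = ≤-refl , refl
... | false rewrite rlm-cons-not-zeroFree 0 zs ez with insertZero-deleteLastZero-from zero zs ez cl
...   | lt , eq = insertZero-cons y (zero ∷ deleteLastZero zs) (zero ∷ zs) _ lt eq
insertZero-deleteLastZero-from y (suc v ∷ zs) ez cl rewrite rlm-cons-not-zeroFree (suc v) zs ez with
    insertZero-deleteLastZero-from (suc v) zs ez cl
... | lt , eq = insertZero-cons y (suc v ∷ deleteLastZero zs) (suc v ∷ zs) _ lt eq

-- Second kind of child: 'raise q' locates the first 0 of the final run of zeros,
-- with previous entry q ≥ 1; after that 0 it inserts q, replaces the other zeros
-- of the run by q and adds one to the later nonzero entries:
--   … q 0^(k+1) W  ↦  … q 0 q^(k+1) (W+1)      (W zero-free).
-- This adds one ascent (0 < q) and one right-to-left minimum.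
raiseEntry : ℕ → ℕ → ℕ
raiseEntry p zero = p
raiseEntry p (suc v) = suc (suc v)

raise : ℕ → List ℕ → List ℕ
raise q [] = []
raise q (zero ∷ ys) = if zerosThenZeroFree ys then zero ∷ q ∷ map (raiseEntry q) ys else zero ∷ raise 0 ys
raise q (suc v ∷ ys) = suc v ∷ raise (suc v) ys

aboveOrZero : ℕ → ℕ → Bool
aboveOrZero p zero = true
aboveOrZero p (suc v) = p ≤ᵇ suc v

allAboveOrZero : ℕ → List ℕ → Bool
allAboveOrZero p [] = true
allAboveOrZero p (v ∷ vs) = aboveOrZero p v ∧ allAboveOrZero p vs

monotoneNonzero⇒allAboveOrZero : ∀ p c xs → p ≤ c → monotoneNonzero c xs ≡ true → allAboveOrZero p xs ≡ true
monotoneNonzero⇒allAboveOrZero p c [] _ _ = refl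
monotoneNonzero⇒allAboveOrZero p c (zero ∷ xs) le e = monotoneNonzero⇒allAboveOrZero p c xs le e
monotoneNonzero⇒allAboveOrZero p c (suc v ∷ xs) le e with ∧-true {c ≤ᵇ suc v} e
... | e1 , e2 rewrite →≤ᵇ {p} {suc v} (≤-trans le (≤ᵇ→ e1)) =
    monotoneNonzero⇒allAboveOrZero p (suc v) xs (≤-trans le (≤ᵇ→ e1)) e2

zeroFree⇒zerosThenZeroFree : ∀ xs → zeroFree xs ≡ true → zerosThenZeroFree xs ≡ true
zeroFree⇒zerosThenZeroFree [] _ = refl
zeroFree⇒zerosThenZeroFree (suc v ∷ xs) e = e

not-zerosThenZeroFree : ∀ xs → zerosThenZeroFree xs ≡ false → zeroFree xs ≡ false
not-zerosThenZeroFree xs e with zeroFree xs in e2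
... | true = ⊥-elim (true≢false (trans (sym (zeroFree⇒zerosThenZeroFree xs e2)) e))
... | false = refl

raiseEntry-<ᵇ : ∀ p a b → aboveOrZero (suc p) a ≡ true → aboveOrZero (suc p) b ≡ true →
    (raiseEntry (suc p) a <ᵇ raiseEntry (suc p) b) ≡ (a <ᵇ b)
raiseEntry-<ᵇ p zero zero _ _ = n<ᵇn p
raiseEntry-<ᵇ p zero (suc b) _ ib = ib
raiseEntry-<ᵇ p (suc a) zero ia _ = →<ᵇf {suc a} {p} (≤-trans (≤-pred (≤ᵇ→ {suc p} {suc a} ia)) (n≤1+n a))
raiseEntry-<ᵇ p (suc a) (suc b) _ _ = refl

ascFrom-raiseEntries : ∀ p a xs → aboveOrZero (suc p) a ≡ true → allAboveOrZero (suc p) xs ≡ true →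
    ascFrom (raiseEntry (suc p) a) (map (raiseEntry (suc p)) xs) ≡ ascFrom a xs
ascFrom-raiseEntries p a [] _ _ = refl
ascFrom-raiseEntries p a (x ∷ xs) ia ad =
  cong₂ _+_ (cong bit (raiseEntry-<ᵇ p a x ia (proj₁ (∧-true {aboveOrZero (suc p) x} ad))))
      (ascFrom-raiseEntries p x xs (proj₁ (∧-true {aboveOrZero (suc p) x} ad))
      (proj₂ (∧-true {aboveOrZero (suc p) x} ad)))

allGreater-raiseEntries : ∀ p a xs → aboveOrZero (suc p) a ≡ true → allAboveOrZero (suc p) xs ≡ true →
    allGreater (raiseEntry (suc p) a) (map (raiseEntry (suc p)) xs) ≡ allGreater a xs
allGreater-raiseEntries p a [] _ _ = refl
allGreater-raiseEntries p a (x ∷ xs) ia ad =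
  cong₂ _∧_ (raiseEntry-<ᵇ p a x ia (proj₁ (∧-true {aboveOrZero (suc p) x} ad)))
      (allGreater-raiseEntries p a xs ia (proj₂ (∧-true {aboveOrZero (suc p) x} ad)))

rlm-raiseEntries : ∀ p xs → allAboveOrZero (suc p) xs ≡ true → rlm (map (raiseEntry (suc p)) xs) ≡ rlm xs
rlm-raiseEntries p [] _ = refl
rlm-raiseEntries p (x ∷ xs) ad =
  trans (rlm-cons (raiseEntry (suc p) x) (map (raiseEntry (suc p)) xs))
   (trans (cong₂ (λ u v → bit u + v) (allGreater-raiseEntries p x xs
       (proj₁ (∧-true {aboveOrZero (suc p) x} ad)) (proj₂ (∧-true {aboveOrZero (suc p) x} ad)))
       (rlm-raiseEntries p xs (proj₂ (∧-true {aboveOrZero (suc p) x} ad))))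
    (sym (rlm-cons x xs)))

ascSeqFrom-raiseEntries : ∀ p a k xs → aboveOrZero (suc p) a ≡ true →
    allAboveOrZero (suc p) xs ≡ true → suc p ≤ suc k →
       ascSeqFrom a k xs ≡ true → ascSeqFrom (raiseEntry (suc p) a) (suc k)
           (map (raiseEntry (suc p)) xs) ≡ true
ascSeqFrom-raiseEntries p a k [] _ _ _ _ = refl
ascSeqFrom-raiseEntries p a k (x ∷ xs) ia ad le s
  rewrite ascSeqFrom-cons a k x xs | ascSeqFrom-cons (raiseEntry (suc p) a) (suc k) (raiseEntry (suc p) x)
      (map (raiseEntry (suc p)) xs)
        | raiseEntry-<ᵇ p a x ia (proj₁ (∧-true {aboveOrZero (suc p) x} ad))
        | +-suc (bit (a <ᵇ x)) k =
  let s1 = proj₁ (∧-true {x <ᵇ suc (suc k)} s) in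
  let s2 = proj₂ (∧-true {x <ᵇ suc (suc k)} s) in
  let ih = ascSeqFrom-raiseEntries p x (bit (a <ᵇ x) + k) xs (proj₁ (∧-true {aboveOrZero (suc p) x} ad))
          (proj₂ (∧-true {aboveOrZero (suc p) x} ad))
             (≤-trans le (s≤s (m≤n+m k _))) s2 in
  cong₂ _∧_ (raiseEntry-bounded x s1) ih
  where
  raiseEntry-bounded : ∀ x → (x <ᵇ suc (suc k)) ≡ true → (raiseEntry (suc p) x <ᵇ suc (suc (suc k))) ≡ true
  raiseEntry-bounded zero _ = →<ᵇ (s≤s (≤-trans le (n≤1+n _)))
  raiseEntry-bounded (suc v) e = e

raiseEntries-positive : ∀ p xs → allGreater 0 (map (raiseEntry (suc p)) xs) ≡ true
raiseEntries-positive p [] = refl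
raiseEntries-positive p (zero ∷ xs) = raiseEntries-positive p xs
raiseEntries-positive p (suc v ∷ xs) = raiseEntries-positive p xs

raiseEntries-zeroFree : ∀ p xs → zeroFree (map (raiseEntry (suc p)) xs) ≡ true
raiseEntries-zeroFree p xs = positive⇒zeroFree (map (raiseEntry (suc p)) xs) (raiseEntries-positive p xs)

monotoneNonzero-raiseEntries-positive : ∀ p c zs → zeroFree zs ≡ true → monotoneNonzero (suc c) zs ≡ true →
    monotoneNonzero (suc (suc c)) (map (raiseEntry p) zs) ≡ true
monotoneNonzero-raiseEntries-positive p c [] _ _ = refl
monotoneNonzero-raiseEntries-positive p c (suc w ∷ zs) zf e with ∧-true {suc c ≤ᵇ suc w} e
... | e1 , e2 = cong₂ _∧_ e1 (monotoneNonzero-raiseEntries-positive p w zs zf e2)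

monotoneNonzero-raiseEntries : ∀ p ys → zerosThenZeroFree ys ≡ true → monotoneNonzero (suc p) ys ≡ true →
    monotoneNonzero (suc p) (map (raiseEntry (suc p)) ys) ≡ true
monotoneNonzero-raiseEntries p [] _ _ = refl
monotoneNonzero-raiseEntries p (zero ∷ ys) z e = cong₂ _∧_ (→≤ᵇ {suc p} ≤-refl)
    (monotoneNonzero-raiseEntries p ys z e)
monotoneNonzero-raiseEntries p (suc v ∷ ys) z e with ∧-true {suc p ≤ᵇ suc v} e
... | e1 , e2 = cong₂ _∧_ (→≤ᵇ {suc p} {suc (suc v)} (≤-trans (≤ᵇ→ e1) (n≤1+n _)))
    (monotoneNonzero-raiseEntries-positive (suc p) v ys z e2)

-- Invariants of the recursion of 'raise q L': q is the previous entry, it is 0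
-- only in front of a list that is not yet the final run of zeros, and b is the
-- bound for the nonzero entries, equal to q unless q = 0.
RaiseSite : ℕ → List ℕ → Set
RaiseSite q L = q ≡ 0 → zerosThenZeroFree L ≡ false

BoundAt : ℕ → ℕ → Set
BoundAt q b = q ≢ 0 → b ≡ q

raise-has-zero : ∀ q L → zeroFree L ≡ false → zeroFree (raise q L) ≡ false
raise-has-zero q (zero ∷ ys) _ with zerosThenZeroFree ys
... | true = refl
... | false = refl
raise-has-zero q (suc v ∷ ys) e = raise-has-zero (suc v) ys e

length-raise : ∀ q L → zeroFree L ≡ false → length (raise q L) ≡ suc (length L)
length-raise q (zero ∷ ys) _ with zerosThenZeroFree ys in z
... | true = cong (λ u → suc (suc u)) (length-map (raiseEntry q) ys)
... | false = cong suc (length-raise 0 ys (not-zerosThenZeroFree ys z))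
length-raise q (suc v ∷ ys) e = cong suc (length-raise (suc v) ys e)

ascFrom-raise : ∀ q b L → RaiseSite q L → BoundAt q b → monotoneNonzero b L ≡ true → zeroFree L ≡ false →
    ascFrom q (raise q L) ≡ suc (ascFrom q L)
ascFrom-raise q b (zero ∷ ys) iv bound nzb _ with zerosThenZeroFree ys in z
ascFrom-raise zero b (zero ∷ ys) iv bound nzb _ | true = ⊥-elim (true≢false (iv refl))
ascFrom-raise (suc q) b (zero ∷ ys) iv bound nzb _ | true with bound (λ ())
... | refl =
  cong suc (ascFrom-raiseEntries q zero ys refl (monotoneNonzero⇒allAboveOrZero (suc q)
      (suc q) ys ≤-refl nzb))
ascFrom-raise q b (zero ∷ ys) iv bound nzb _ | false =
    ascFrom-raise 0 b ys (λ _ → z) (λ ne → ⊥-elim (ne refl)) nzb (not-zerosThenZeroFree ys z)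
ascFrom-raise q b (suc v ∷ ys) iv bound nzb e =
  trans (cong (bit (q <ᵇ suc v) +_) (ascFrom-raise (suc v) (suc v) ys (λ ()) (λ _ → refl)
      (proj₂ (∧-true {b ≤ᵇ suc v} nzb)) e))
        (+-suc _ _)

ascSeqFrom-raise : ∀ q b k L → RaiseSite q L → BoundAt q b → (q ≢ 0 → q ≤ suc k) →
    monotoneNonzero b L ≡ true → zeroFree L ≡ false →
       ascSeqFrom q k L ≡ true → ascSeqFrom q k (raise q L) ≡ true
ascSeqFrom-raise q b k (zero ∷ ys) iv bound hk nzb _ s with zerosThenZeroFree ys in z
ascSeqFrom-raise zero b k (zero ∷ ys) iv bound hk nzb _ s | true = ⊥-elim (true≢false (iv refl))
ascSeqFrom-raise (suc q) b k (zero ∷ ys) iv bound hk nzb _ s | true with bound (λ ())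
... | refl =
  cong₂ _∧_ (→<ᵇ (s≤s (hk (λ ())))) (ascSeqFrom-raiseEntries q zero k ys refl
      (monotoneNonzero⇒allAboveOrZero (suc q) (suc q) ys ≤-refl nzb) (hk (λ ())) s)
ascSeqFrom-raise q b k (zero ∷ ys) iv bound hk nzb _ s | false =
  ascSeqFrom-raise 0 b k ys (λ _ → z) (λ ne → ⊥-elim (ne refl)) (λ ne → ⊥-elim (ne refl)) nzb
      (not-zerosThenZeroFree ys z) s
ascSeqFrom-raise q b k (suc v ∷ ys) iv bound hk nzb e s
  rewrite ascSeqFrom-cons q k (suc v) (raise (suc v) ys) | ascSeqFrom-cons q k (suc v) ys =
  let s1 = proj₁ (∧-true {suc v <ᵇ suc (suc k)} s) in
  cong₂ _∧_ s1 (ascSeqFrom-raise (suc v) (suc v) _ ys (λ ()) (λ _ → refl)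
                 (λ _ → ≤-trans (≤-pred (<ᵇ→ s1)) (s≤s (m≤n+m k _)))
                 (proj₂ (∧-true {b ≤ᵇ suc v} nzb)) e (proj₂ (∧-true {suc v <ᵇ suc (suc k)} s)))

rlm-raise : ∀ q b L → RaiseSite q L → BoundAt q b → monotoneNonzero b L ≡ true → zeroFree L ≡ false →
    rlm (raise q L) ≡ suc (rlm L)
rlm-raise q b (zero ∷ ys) iv bound nzb _ with zerosThenZeroFree ys in z
rlm-raise zero b (zero ∷ ys) iv bound nzb _ | true = ⊥-elim (true≢false (iv refl))
rlm-raise (suc q) b (zero ∷ ys) iv bound nzb _ | true with bound (λ ())
... | refl =
  trans (rlm-cons zero (suc q ∷ map (raiseEntry (suc q)) ys))
    (cong₂ _+_ (cong bit (raiseEntries-positive q ys))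
        (rlm-raiseEntries q (zero ∷ ys) (monotoneNonzero⇒allAboveOrZero (suc q) (suc q) ys ≤-refl nzb)))
rlm-raise q b (zero ∷ ys) iv bound nzb _ | false =
  trans (rlm-cons-not-zeroFree zero (raise 0 ys) (raise-has-zero 0 ys (not-zerosThenZeroFree ys z)))
   (trans (rlm-raise 0 b ys (λ _ → z) (λ ne → ⊥-elim (ne refl)) nzb (not-zerosThenZeroFree ys z))
       (cong suc (sym (rlm-cons-not-zeroFree zero ys (not-zerosThenZeroFree ys z)))))
rlm-raise q b (suc v ∷ ys) iv bound nzb e =
  trans (rlm-cons-not-zeroFree (suc v) (raise (suc v) ys) (raise-has-zero (suc v) ys e))
   (trans (rlm-raise (suc v) (suc v) ys (λ ()) (λ _ → refl) (proj₂ (∧-true {b ≤ᵇ suc v} nzb)) e)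
       (cong suc (sym (rlm-cons-not-zeroFree (suc v) ys e))))

monotoneNonzero-raise : ∀ q b L → RaiseSite q L → BoundAt q b → monotoneNonzero b L ≡ true →
    zeroFree L ≡ false → monotoneNonzero b (raise q L) ≡ true
monotoneNonzero-raise q b (zero ∷ ys) iv bound nzb _ with zerosThenZeroFree ys in z
monotoneNonzero-raise zero b (zero ∷ ys) iv bound nzb _ | true = ⊥-elim (true≢false (iv refl))
monotoneNonzero-raise (suc q) b (zero ∷ ys) iv bound nzb _ | true with bound (λ ())
... | refl =
  cong₂ _∧_ (→≤ᵇ {suc q} ≤-refl) (monotoneNonzero-raiseEntries q ys z nzb)
monotoneNonzero-raise q b (zero ∷ ys) iv bound nzb _ | false =
    monotoneNonzero-raise 0 b ys (λ _ → z) (λ ne → ⊥-elim (ne refl)) nzb (not-zerosThenZeroFree ys z)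
monotoneNonzero-raise q b (suc v ∷ ys) iv bound nzb e =
  cong₂ _∧_ (proj₁ (∧-true {b ≤ᵇ suc v} nzb)) (monotoneNonzero-raise (suc v) (suc v) ys (λ ()) (λ _ → refl)
      (proj₂ (∧-true {b ≤ᵇ suc v} nzb)) e)

lastZeroAfterMin-raise : ∀ q b L → RaiseSite q L → BoundAt q b → monotoneNonzero b L ≡ true →
    zeroFree L ≡ false → lastZeroAfterMin q (raise q L) ≡ false
lastZeroAfterMin-raise q b (zero ∷ ys) iv bound nzb _ with zerosThenZeroFree ys in z
lastZeroAfterMin-raise zero b (zero ∷ ys) iv bound nzb _ | true = ⊥-elim (true≢false (iv refl))
lastZeroAfterMin-raise (suc q) b (zero ∷ ys) iv bound nzb _ | true rewrite raiseEntries-zeroFree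
    q ys | n<ᵇn q = refl
lastZeroAfterMin-raise q b (zero ∷ ys) iv bound nzb _ | false rewrite raise-has-zero 0 ys
    (not-zerosThenZeroFree ys z) =
  lastZeroAfterMin-raise 0 b ys (λ _ → z) (λ ne → ⊥-elim (ne refl)) nzb (not-zerosThenZeroFree ys z)
lastZeroAfterMin-raise q b (suc v ∷ ys) iv bound nzb e =
    lastZeroAfterMin-raise (suc v) (suc v) ys (λ ()) (λ _ → refl) (proj₂ (∧-true {b ≤ᵇ suc v} nzb)) e

-- Inverse of raise: if the last 0 is followed by the zero-free block W and
-- preceded by q, 'lower q' deletes that 0 and, in W, replaces the entries ≤ q
-- by 0 and decreases the larger ones by one.
lowerEntry : ℕ → ℕ → ℕ
lowerEntry q v = if v ≤ᵇ q then 0 else pred v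

lower : ℕ → List ℕ → List ℕ
lower q [] = []
lower q (zero ∷ ys) = if zeroFree ys then map (lowerEntry q) ys else zero ∷ lower 0 ys
lower q (suc v ∷ ys) = suc v ∷ lower (suc v) ys

lowerEntry-self : ∀ q → lowerEntry q q ≡ 0
lowerEntry-self q rewrite →≤ᵇ {q} {q} ≤-refl = refl

lowerEntry-above : ∀ q w → q < w → lowerEntry q w ≡ pred w
lowerEntry-above q w lt rewrite →≤ᵇf {w} {q} lt = refl

lowerEntries-raiseEntries : ∀ p xs → allAboveOrZero (suc p) xs ≡ true →
    map (lowerEntry (suc p)) (map (raiseEntry (suc p)) xs) ≡ xs
lowerEntries-raiseEntries p [] _ = refl
lowerEntries-raiseEntries p (zero ∷ xs) ad = cong₂ _∷_ (lowerEntry-self (suc p))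
    (lowerEntries-raiseEntries p xs (proj₂ (∧-true {true} ad)))
lowerEntries-raiseEntries p (suc v ∷ xs) ad =
  cong₂ _∷_ (lowerEntry-above (suc p) (suc (suc v)) (s≤s (≤ᵇ→ (proj₁ (∧-true {suc p ≤ᵇ suc v} ad)))))
      (lowerEntries-raiseEntries p xs (proj₂ (∧-true {suc p ≤ᵇ suc v} ad)))

lower-raise : ∀ q b L → RaiseSite q L → BoundAt q b → monotoneNonzero b L ≡ true → zeroFree L ≡ false →
    lower q (raise q L) ≡ L
lower-raise q b (zero ∷ ys) iv bound nzb _ with zerosThenZeroFree ys in z
lower-raise zero b (zero ∷ ys) iv bound nzb _ | true = ⊥-elim (true≢false (iv refl))
lower-raise (suc q) b (zero ∷ ys) iv bound nzb _ | true with bound (λ ())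
... | refl rewrite raiseEntries-zeroFree q ys = cong₂ _∷_ (lowerEntry-self (suc q))
    (lowerEntries-raiseEntries q ys (monotoneNonzero⇒allAboveOrZero (suc q) (suc q) ys ≤-refl nzb))
lower-raise q b (zero ∷ ys) iv bound nzb _ | false rewrite raise-has-zero 0 ys (not-zerosThenZeroFree ys z) =
  cong (zero ∷_) (lower-raise 0 b ys (λ _ → z) (λ ne → ⊥-elim (ne refl)) nzb (not-zerosThenZeroFree ys z))
lower-raise q b (suc v ∷ ys) iv bound nzb e =
  cong (suc v ∷_) (lower-raise (suc v) (suc v) ys (λ ()) (λ _ → refl) (proj₂ (∧-true {b ≤ᵇ suc v} nzb)) e)

monotoneNonzero⇒allGreater : ∀ q c W → zeroFree W ≡ true → monotoneNonzero c W ≡ true → q < c →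
    allGreater q W ≡ true
monotoneNonzero⇒allGreater q c [] _ _ _ = refl
monotoneNonzero⇒allGreater q c (suc w ∷ W) zf e lt with ∧-true {c ≤ᵇ suc w} e
... | e1 , e2 rewrite →<ᵇ {q} {suc w} (<-≤-trans lt (≤ᵇ→ e1)) =
    monotoneNonzero⇒allGreater q (suc w) W zf e2 (<-≤-trans lt (≤ᵇ→ e1))

lastBlock-head : ∀ q W → zeroFree W ≡ true → monotoneNonzero q W ≡ true → allGreater q W ≡ false →
    Σ (List ℕ) λ W'' → W ≡ q ∷ W''
lastBlock-head q [] _ _ ()
lastBlock-head q (suc w ∷ W) zf e ag with ∧-true {q ≤ᵇ suc w} e
... | e1 , e2 with q <ᵇ suc w in e3
...   | true = ⊥-elim (true≢false (trans (sym (monotoneNonzero⇒allGreater q (suc w) W zf e2 (<ᵇ→ e3))) ag))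
...   | false = W , cong (_∷ W) (sym (≤-antisym (≤ᵇ→ e1) (<ᵇf→ e3)))

monotoneNonzero-weaken : ∀ {b c} W → b ≤ c → monotoneNonzero c W ≡ true → monotoneNonzero b W ≡ true
monotoneNonzero-weaken [] _ _ = refl
monotoneNonzero-weaken (zero ∷ W) le e = monotoneNonzero-weaken W le e
monotoneNonzero-weaken {b} {c} (suc u ∷ W) le e with ∧-true {c ≤ᵇ suc u} e
... | e1 , e2 rewrite →≤ᵇ {b} {suc u} (≤-trans le (≤ᵇ→ e1)) = e2

raiseEntries-lowerEntries : ∀ q W → zeroFree W ≡ true → monotoneNonzero (suc q) W ≡ true →
    map (raiseEntry (suc q)) (map (lowerEntry (suc q)) W) ≡ W
raiseEntries-lowerEntries q [] _ _ = refl
raiseEntries-lowerEntries q (suc w ∷ W) zf e with ∧-true {suc q ≤ᵇ suc w} e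
... | e1 , e2 with suc w ≤ᵇ suc q in e3
...   | true = cong₂ _∷_ (sym (≤-antisym (≤ᵇ→ e3) (≤ᵇ→ e1)))
    (raiseEntries-lowerEntries q W zf (subst (λ c → monotoneNonzero c W ≡ true)
    (≤-antisym (≤ᵇ→ e3) (≤ᵇ→ e1)) e2))
...   | false = cong₂ _∷_ (raiseEntry-pred w (≤ᵇf→ e3))
    (raiseEntries-lowerEntries q W zf (monotoneNonzero-weaken W (≤ᵇ→ e1) e2))
  where
  raiseEntry-pred : ∀ w → suc q < suc w → raiseEntry (suc q) (pred (suc w)) ≡ suc w
  raiseEntry-pred (suc u) _ = refl
  raiseEntry-pred zero (s≤s ())

zeroFree-lowerEntries : ∀ q c W → zeroFree W ≡ true → monotoneNonzero c W ≡ true → suc q < c →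
    zeroFree (map (lowerEntry (suc q)) W) ≡ true
zeroFree-lowerEntries q c [] _ _ _ = refl
zeroFree-lowerEntries q c (suc w ∷ W) zf e lt with ∧-true {c ≤ᵇ suc w} e
... | e1 , e2 rewrite lowerEntry-above (suc q) (suc w) (<-≤-trans lt (≤ᵇ→ e1)) =
    zeroFree-lowered-cons w (<-≤-trans lt (≤ᵇ→ e1)) e2
  where
  zeroFree-lowered-cons : ∀ w → suc q < suc w → monotoneNonzero (suc w) W ≡ true →
      zeroFree (pred (suc w) ∷ map (lowerEntry (suc q)) W) ≡ true
  zeroFree-lowered-cons zero (s≤s ()) _
  zeroFree-lowered-cons (suc u) lt' e' = zeroFree-lowerEntries q (suc (suc u)) W zf e' lt'

zerosThenZeroFree-positive : ∀ w rest → 0 < w → zeroFree rest ≡ true → zerosThenZeroFree (w ∷ rest) ≡ true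
zerosThenZeroFree-positive (suc w) rest _ e = e

zerosThenZeroFree-lowerEntries : ∀ q W → zeroFree W ≡ true → monotoneNonzero (suc q) W ≡ true →
    zerosThenZeroFree (map (lowerEntry (suc q)) W) ≡ true
zerosThenZeroFree-lowerEntries q [] _ _ = refl
zerosThenZeroFree-lowerEntries q (suc w ∷ W) zf e with ∧-true {suc q ≤ᵇ suc w} e
... | e1 , e2 with suc w ≤ᵇ suc q in e3
...   | true = zerosThenZeroFree-lowerEntries q W zf
    (subst (λ c → monotoneNonzero c W ≡ true) (≤-antisym (≤ᵇ→ e3) (≤ᵇ→ e1)) e2)
...   | false = zerosThenZeroFree-positive w _ (≤-<-trans z≤n (≤-pred (≤ᵇf→ e3)))
    (zeroFree-lowerEntries q (suc w) W zf e2 (≤ᵇf→ e3))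

lowerEntry-<ᵇ : ∀ q a b → suc q ≤ a → suc q ≤ b → (lowerEntry (suc q) a <ᵇ lowerEntry (suc q) b) ≡ (a <ᵇ b)
lowerEntry-<ᵇ q a b la lb with a ≤ᵇ suc q in e1 | b ≤ᵇ suc q in e2
... | true | true =
  let ea = ≤-antisym (≤ᵇ→ e1) la in
  let eb = ≤-antisym (≤ᵇ→ e2) lb in
  sym (trans (cong (_<ᵇ b) (trans ea (sym eb))) (n<ᵇn b))
... | true | false =
  let ea = ≤-antisym (≤ᵇ→ e1) la in
  trans (→<ᵇ {0} {pred b} (≤-trans (s≤s z≤n) (<⇒≤pred (≤ᵇf→ {b} {suc q} e2))))
      (sym (→<ᵇ (subst (_< b) (sym ea) (≤ᵇf→ e2))))
... | false | true =
  let eb = ≤-antisym (≤ᵇ→ e2) lb in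
  sym (→<ᵇf {a} {b} (<⇒≤ (subst (_< a) (sym eb) (≤ᵇf→ e1))))
... | false | false = pred-<ᵇ a b (≤-<-trans z≤n (≤ᵇf→ e1)) (≤-<-trans z≤n (≤ᵇf→ e2))

lowerEntry-bounded : ∀ q w k → (w <ᵇ suc (suc (suc k))) ≡ true → (lowerEntry (suc q) w <ᵇ suc (suc k)) ≡ true
lowerEntry-bounded q w k e with w ≤ᵇ suc q
... | true = refl
... | false = pred-bounded w e
  where
  pred-bounded : ∀ w → (w <ᵇ suc (suc (suc k))) ≡ true → (pred w <ᵇ suc (suc k)) ≡ true
  pred-bounded zero _ = refl
  pred-bounded (suc w) e = e

ascSeqFrom-lowerEntries : ∀ q a k W → suc q ≤ a → zeroFree W ≡ true → monotoneNonzero a W ≡ true →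
    ascSeqFrom a (suc k) W ≡ true →
           ascSeqFrom (lowerEntry (suc q) a) k (map (lowerEntry (suc q)) W) ≡ true
ascSeqFrom-lowerEntries q a k [] _ _ _ _ = refl
ascSeqFrom-lowerEntries q a k (suc w ∷ W) la zf nza s
  rewrite ascSeqFrom-cons a (suc k) (suc w) W | ascSeqFrom-cons (lowerEntry (suc q) a) k
      (lowerEntry (suc q) (suc w)) (map (lowerEntry (suc q)) W) =
  let n1 = proj₁ (∧-true {a ≤ᵇ suc w} nza) in
  let n2 = proj₂ (∧-true {a ≤ᵇ suc w} nza) in
  let s1 = proj₁ (∧-true {suc w <ᵇ suc (suc (suc k))} s) in
  let s2 = proj₂ (∧-true {suc w <ᵇ suc (suc (suc k))} s) in
  let lw = ≤-trans la (≤ᵇ→ n1) in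
  cong₂ _∧_ (lowerEntry-bounded q (suc w) k s1)
    (subst (λ u → ascSeqFrom (lowerEntry (suc q) (suc w)) (bit u + k) (map (lowerEntry (suc q)) W) ≡ true)
        (sym (lowerEntry-<ᵇ q a (suc w) la lw))
      (ascSeqFrom-lowerEntries q (suc w) (bit (a <ᵇ suc w) + k) W lw zf n2
          (subst (λ u → ascSeqFrom (suc w) u W ≡ true) (+-suc _ k) s2)))

lowerBound : ℕ → ℕ → ℕ
lowerBound q c = if c ≤ᵇ suc q then suc q else pred c

monotoneNonzero-cons : ∀ b w rest → 0 < w → b ≤ w → monotoneNonzero w rest ≡ true →
    monotoneNonzero b (w ∷ rest) ≡ true
monotoneNonzero-cons b (suc w) rest _ le e = cong₂ _∧_ (→≤ᵇ le) e

monotoneNonzero-lowerEntries : ∀ q c W → suc q ≤ c → zeroFree W ≡ true → monotoneNonzero c W ≡ true →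
    monotoneNonzero (lowerBound q c) (map (lowerEntry (suc q)) W) ≡ true
monotoneNonzero-lowerEntries q c [] _ _ _ = refl
monotoneNonzero-lowerEntries q c (suc w ∷ W) lc zf e with ∧-true {c ≤ᵇ suc w} e
... | e1 , e2 with suc w ≤ᵇ suc q in e3
...   | true =
  let ew = ≤-antisym (≤ᵇ→ e3) (≤-trans lc (≤ᵇ→ e1)) in
  let ec = ≤-antisym (≤-trans (≤ᵇ→ e1) (≤ᵇ→ e3)) lc in
  subst (λ u → monotoneNonzero (lowerBound q u) (map (lowerEntry (suc q)) W) ≡ true) (trans ew (sym ec))
    (monotoneNonzero-lowerEntries q (suc w) W (≤-trans lc (≤ᵇ→ e1)) zf e2)
...   | false =
  let ih = monotoneNonzero-lowerEntries q (suc w) W (≤-trans lc (≤ᵇ→ e1)) zf e2 in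
  monotoneNonzero-cons (lowerBound q c) w _ (≤-<-trans z≤n (≤-pred (≤ᵇf→ e3))) (lowerBound≤ c e1)
    (subst (λ u → monotoneNonzero u (map (lowerEntry (suc q)) W) ≡ true) (lowerBound-above e3) ih)
  where
  lowerBound-above : (suc w ≤ᵇ suc q) ≡ false → lowerBound q (suc w) ≡ w
  lowerBound-above e rewrite e = refl
  lowerBound≤ : ∀ c → (c ≤ᵇ suc w) ≡ true → lowerBound q c ≤ w
  lowerBound≤ c ec with c ≤ᵇ suc q in e4
  ... | true = ≤-pred (≤ᵇf→ e3)
  ... | false = pred-mono-≤ (≤ᵇ→ {c} {suc w} ec)

lowerEntries-has-zero : ∀ q W → allGreater q W ≡ false → zeroFree (map (lowerEntry q) W) ≡ false
lowerEntries-has-zero q (w ∷ W) ag with q <ᵇ w in e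
... | false rewrite →≤ᵇ {w} {q} (<ᵇf→ e) = refl
... | true with lowerEntry q w
...   | zero = refl
...   | suc _ = lowerEntries-has-zero q W ag

length-lower : ∀ q L → zeroFree L ≡ false → suc (length (lower q L)) ≡ length L
length-lower q (zero ∷ ys) _ with zeroFree ys in z
... | true = cong suc (length-map (lowerEntry q) ys)
... | false = cong suc (length-lower 0 ys z)
length-lower q (suc v ∷ ys) e = cong suc (length-lower (suc v) ys e)

lower-has-zero : ∀ q L → zeroFree L ≡ false → lastZeroAfterMin q L ≡ false → zeroFree (lower q L) ≡ false
lower-has-zero q (zero ∷ ys) _ cl with zeroFree ys
... | true = lowerEntries-has-zero q ys cl
... | false = refl
lower-has-zero q (suc v ∷ ys) e cl = lower-has-zero (suc v) ys e cl

lower-not-zerosThenZeroFree : ∀ L → zeroFree L ≡ false → lastZeroAfterMin 0 L ≡ false →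
    zerosThenZeroFree (lower 0 L) ≡ false
lower-not-zerosThenZeroFree (zero ∷ ys) _ cl with zeroFree ys in z
... | true = ⊥-elim (true≢false (trans (sym (zeroFree⇒positive ys z)) cl))
... | false = lower-not-zerosThenZeroFree ys z cl
lower-not-zerosThenZeroFree (suc v ∷ ys) e cl = lower-has-zero (suc v) ys e cl

ascSeqFrom-lower : ∀ q b k L → BoundAt q b → monotoneNonzero b L ≡ true → zeroFree L ≡ false →
    lastZeroAfterMin q L ≡ false → ascSeqFrom q k L ≡ true → ascSeqFrom q k (lower q L) ≡ true
ascSeqFrom-lower q b k (zero ∷ ys) bound nzb _ cl s with zeroFree ys in z
ascSeqFrom-lower zero b k (zero ∷ ys) bound nzb _ cl s | true =
    ⊥-elim (true≢false (trans (sym (zeroFree⇒positive ys z)) cl))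
ascSeqFrom-lower (suc q) b k (zero ∷ ys) bound nzb _ cl s | true with bound (λ ())
... | refl with lastBlock-head (suc q) ys z nzb cl
...   | W'' , refl rewrite lowerEntry-self (suc q) =
  let s' = proj₂ (∧-true {suc q <ᵇ suc (suc k)} s) in
  let n2 = proj₂ (∧-true {suc q ≤ᵇ suc q} nzb) in
  subst (λ u → ascSeqFrom u k (map (lowerEntry (suc q)) W'') ≡ true) (lowerEntry-self (suc q))
      (ascSeqFrom-lowerEntries q (suc q) k W'' ≤-refl z n2 s')
ascSeqFrom-lower q b k (zero ∷ ys) bound nzb _ cl s | false =
    ascSeqFrom-lower 0 b k ys (λ ne → ⊥-elim (ne refl)) nzb z cl s
ascSeqFrom-lower q b k (suc v ∷ ys) bound nzb e cl s
  rewrite ascSeqFrom-cons q k (suc v) (lower (suc v) ys) | ascSeqFrom-cons q k (suc v) ys =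
  cong₂ _∧_ (proj₁ (∧-true {suc v <ᵇ suc (suc k)} s))
    (ascSeqFrom-lower (suc v) (suc v) _ ys (λ _ → refl) (proj₂ (∧-true {b ≤ᵇ suc v} nzb)) e cl
        (proj₂ (∧-true {suc v <ᵇ suc (suc k)} s)))

monotoneNonzero-lower : ∀ q b L → BoundAt q b → monotoneNonzero b L ≡ true → zeroFree L ≡ false →
    lastZeroAfterMin q L ≡ false → monotoneNonzero b (lower q L) ≡ true
monotoneNonzero-lower q b (zero ∷ ys) bound nzb _ cl with zeroFree ys in z
monotoneNonzero-lower zero b (zero ∷ ys) bound nzb _ cl | true =
    ⊥-elim (true≢false (trans (sym (zeroFree⇒positive ys z)) cl))
monotoneNonzero-lower (suc q) b (zero ∷ ys) bound nzb _ cl | true with bound (λ ())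
... | refl with lastBlock-head (suc q) ys z nzb cl
...   | W'' , refl rewrite lowerEntry-self (suc q) =
  let n2 = proj₂ (∧-true {suc q ≤ᵇ suc q} nzb) in
  subst (λ u → monotoneNonzero u (map (lowerEntry (suc q)) W'') ≡ true) (lowerBound-self q)
      (monotoneNonzero-lowerEntries q (suc q) W'' ≤-refl z n2)
  where
  lowerBound-self : ∀ q → lowerBound q (suc q) ≡ suc q
  lowerBound-self q rewrite →≤ᵇ {suc q} {suc q} ≤-refl = refl
monotoneNonzero-lower q b (zero ∷ ys) bound nzb _ cl | false =
    monotoneNonzero-lower 0 b ys (λ ne → ⊥-elim (ne refl)) nzb z cl
monotoneNonzero-lower q b (suc v ∷ ys) bound nzb e cl =
  cong₂ _∧_ (proj₁ (∧-true {b ≤ᵇ suc v} nzb)) (monotoneNonzero-lower (suc v) (suc v) ys (λ _ → refl)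
      (proj₂ (∧-true {b ≤ᵇ suc v} nzb)) e cl)

raise-lower : ∀ q b L → BoundAt q b → monotoneNonzero b L ≡ true → zeroFree L ≡ false →
    lastZeroAfterMin q L ≡ false → raise q (lower q L) ≡ L
raise-lower q b (zero ∷ ys) bound nzb _ cl with zeroFree ys in z
raise-lower zero b (zero ∷ ys) bound nzb _ cl | true =
    ⊥-elim (true≢false (trans (sym (zeroFree⇒positive ys z)) cl))
raise-lower (suc q) b (zero ∷ ys) bound nzb _ cl | true with bound (λ ())
... | refl with lastBlock-head (suc q) ys z nzb cl
...   | W'' , refl rewrite lowerEntry-self (suc q) | zerosThenZeroFree-lowerEntries q W'' z
    (proj₂ (∧-true {suc q ≤ᵇ suc q} nzb)) | raiseEntries-lowerEntries q W'' z
    (proj₂ (∧-true {suc q ≤ᵇ suc q} nzb)) = refl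
raise-lower q b (zero ∷ ys) bound nzb _ cl | false rewrite lower-not-zerosThenZeroFree ys z cl =
    cong (zero ∷_) (raise-lower 0 b ys (λ ne → ⊥-elim (ne refl)) nzb z cl)
raise-lower q b (suc v ∷ ys) bound nzb e cl = cong (suc v ∷_)
    (raise-lower (suc v) (suc v) ys (λ _ → refl) (proj₂ (∧-true {b ≤ᵇ suc v} nzb)) e cl)

lower-head : ∀ ys → monotoneNonzero 1 ys ≡ true → lastZeroAfterMin 1 (zero ∷ ys) ≡ false → Σ (List ℕ) λ w →
    lower 1 (zero ∷ ys) ≡ zero ∷ w
lower-head ys nzb cl with zeroFree ys in z
... | true with lastBlock-head 1 ys z nzb cl
...   | W'' , refl rewrite lowerEntry-self 1 = map (lowerEntry 1) W'' , refl
lower-head ys nzb cl | false = lower 0 ys , refl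

-- Top level: a nonempty ascent sequence starts with 0, and then the Defs tests
-- coincide with the versions above taken with previous entry 1.
StartsWithZero : List ℕ → Set
StartsWithZero x = Σ (List ℕ) λ ys → x ≡ zero ∷ ys

isAscentSeq-via : ∀ x → StartsWithZero x → isAscentSeq x ≡ ascSeqFrom 1 0 x
isAscentSeq-via .(zero ∷ ys) (ys , refl) = refl

asc-via : ∀ x → StartsWithZero x → asc x ≡ ascFrom 1 x
asc-via .(zero ∷ ys) (ys , refl) = asc≡ascFrom zero ys

contains021-via : ∀ x → StartsWithZero x → contains021 x ≡ not (monotoneNonzero 1 x)
contains021-via .(zero ∷ ys) (ys , refl) = contains021≡nonmonotone ys

zeroFree-via : ∀ x → StartsWithZero x → zeroFree x ≡ false
zeroFree-via .(zero ∷ ys) (ys , refl) = refl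

startsWithZero : ∀ x m → T (isAscentSeq x) → length x ≡ suc m → StartsWithZero x
startsWithZero (zero ∷ ys) m _ _ = ys , refl
startsWithZero (suc v ∷ ys) m () _
startsWithZero [] m _ ()

insertZero-head : ∀ d ys → StartsWithZero (insertZero d (zero ∷ ys))
insertZero-head d ys with allGreater zero ys ∧ (rlm ys ≡ᵇ d)
... | true = zero ∷ ys , refl
... | false = insertZero d ys , refl

raise-head : ∀ ys → StartsWithZero (raise 1 (zero ∷ ys))
raise-head ys with zerosThenZeroFree ys
... | true = _ , refl
... | false = _ , refl

startsWithZero-insertZero : ∀ d x → StartsWithZero x → StartsWithZero (insertZero d x)
startsWithZero-insertZero d .(zero ∷ ys) (ys , refl) = insertZero-head d ys

startsWithZero-raise : ∀ x → StartsWithZero x → StartsWithZero (raise 1 x)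
startsWithZero-raise .(zero ∷ ys) (ys , refl) = raise-head ys

-- An ascent sequence with a single 0 is never a first-kind child: its second
-- entry is 1.
single-zero-not-after-min : ∀ y ys → ascSeqFrom 0 0 (y ∷ ys) ≡ true → zeroFree (y ∷ ys) ≡ true →
    allGreater 1 (y ∷ ys) ≡ false
single-zero-not-after-min (suc zero) ys _ _ = refl
single-zero-not-after-min (suc (suc y)) ys () _

insertZero-deleteLastZero : ∀ x m → T (isAscentSeq x) → length x ≡ suc (suc m) → lastZeroAfterMin 1 x ≡ true →
        (pred (rlm x) < rlm (deleteLastZero x)) × (insertZero (pred (rlm x)) (deleteLastZero x) ≡ x)
insertZero-deleteLastZero (zero ∷ []) m _ () _
insertZero-deleteLastZero (zero ∷ y ∷ ys) m iA _ cl with zeroFree (y ∷ ys) in z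
... | true = ⊥-elim (true≢false (trans (sym cl) (single-zero-not-after-min y ys (T→ iA) z)))
... | false rewrite rlm-cons-not-zeroFree zero (y ∷ ys) z = insertZero-deleteLastZero-from zero (y ∷ ys) z cl
insertZero-deleteLastZero (suc v ∷ ys) m () _ _
insertZero-deleteLastZero [] m _ () _

AscSet-≡ : ∀ {n a r} (u v : AscSet n a r) → proj₁ u ≡ proj₁ v → u ≡ v
AscSet-≡ (x , p1 , p2 , p3 , p4 , p5) (.x , q1 , q2 , q3 , q4 , q5) refl
  rewrite T-irrelevant p1 q1 | ≡-irrelevant p2 q2 | T-irrelevant p3 q3 | ≡-irrelevant p4 q4
      | ≡-irrelevant p5 q5 = refl

module AscStep (n : ℕ) where
  open ChildrenEquality {AscSet} proj₁ AscSet-≡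

  record Good (x : List ℕ) (m : ℕ) : Set where
    field
      head-zero : StartsWithZero x
      ascent-condition : ascSeqFrom 1 0 x ≡ true
      nonzero-monotone : monotoneNonzero 1 x ≡ true
      has-zero : zeroFree x ≡ false
      length≡ : length x ≡ m

  good : ∀ {m a r} (u : AscSet (suc m) a r) → Good (proj₁ u) (suc m)
  good {m} (x , iA , len , av , ea , er) = record
    { head-zero = hz
    ; ascent-condition = trans (sym (isAscentSeq-via x hz)) (T→ iA)
    ; nonzero-monotone = not-false (trans (sym (contains021-via x hz)) (Tn→ av))
    ; has-zero = zeroFree-via x hz
    ; length≡ = len }
    where
    hz : StartsWithZero x
    hz = startsWithZero x m iA len

  fromGood : ∀ {m a r} x → Good x (suc m) → asc x ≡ a → rlm x ≡ r → AscSet (suc m) a r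
  fromGood x G ea er =
    x , →T (trans (isAscentSeq-via x head-zero) ascent-condition) , length≡ ,
    →Tn (trans (contains021-via x head-zero) (cong not nonzero-monotone)) , ea , er
    where open Good G

  insertZero-good : ∀ x d → Good x (suc n) → d < rlm x → Good (insertZero d x) (suc (suc n))
  insertZero-good x d G lt = record
    { head-zero = startsWithZero-insertZero d x (Good.head-zero G)
    ; ascent-condition = trans (ascSeqFrom-insertZero d x lt 1 0) (Good.ascent-condition G)
    ; nonzero-monotone = trans (monotoneNonzero-insertZero d x 1) (Good.nonzero-monotone G)
    ; has-zero = insertZero-has-zero d x lt
    ; length≡ = trans (length-insertZero d x lt) (cong suc (Good.length≡ G)) }

  good-asc-insertZero : ∀ x d → Good x (suc n) → d < rlm x → asc (insertZero d x) ≡ asc x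
  good-asc-insertZero x d G lt = trans (asc-via _ (startsWithZero-insertZero d x (Good.head-zero G)))
      (trans (ascFrom-insertZero d x lt 1) (sym (asc-via x (Good.head-zero G))))

  deleteLastZero-good : ∀ x' → Good x' (suc (suc n)) → T (isAscentSeq x') → lastZeroAfterMin 1 x' ≡ true →
          let d = pred (rlm x') in (d < rlm (deleteLastZero x')) × (insertZero d (deleteLastZero x') ≡ x') ×
                  Good (deleteLastZero x') (suc n)
  deleteLastZero-good x' G iA cl =
    let J = insertZero-deleteLastZero x' n iA (Good.length≡ G) cl in
    let lt = proj₁ J in
    let eq = proj₂ J in
    let x = deleteLastZero x' in
    let d = pred (rlm x') in
    lt , eq ,
    record
    { head-zero = startsWithZero-deleteLastZero x' (Good.head-zero G) cl (Good.length≡ G)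
        (Good.ascent-condition G)
    ; ascent-condition = trans (sym (ascSeqFrom-insertZero d x lt 1 0))
        (trans (cong (ascSeqFrom 1 0) eq) (Good.ascent-condition G))
    ; nonzero-monotone = trans (sym (monotoneNonzero-insertZero d x 1))
        (trans (cong (monotoneNonzero 1) eq) (Good.nonzero-monotone G))
    ; has-zero = zeroFree-via x (startsWithZero-deleteLastZero x' (Good.head-zero G) cl (Good.length≡ G)
        (Good.ascent-condition G))
    ; length≡ = suc-injective (trans (sym (length-insertZero d x lt))
        (trans (cong length eq) (Good.length≡ G))) }
    where
    startsWithZero-deleteLastZero : ∀ x' → StartsWithZero x' → lastZeroAfterMin 1 x' ≡ true →
        length x' ≡ suc (suc n) → ascSeqFrom 1 0 x' ≡ true → StartsWithZero (deleteLastZero x')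
    startsWithZero-deleteLastZero .(zero ∷ ys) (ys , refl) cl' len s with zeroFree ys in z
    startsWithZero-deleteLastZero .(zero ∷ []) ([] , refl) cl' () s | true
    startsWithZero-deleteLastZero .(zero ∷ y ∷ ys) (y ∷ ys , refl) cl' len s | true =
        ⊥-elim (true≢false (trans (sym cl') (single-zero-not-after-min y ys s z)))
    startsWithZero-deleteLastZero .(zero ∷ ys) (ys , refl) cl' len s | false = deleteLastZero ys , refl

  raise-good : ∀ x → Good x (suc n) → Good (raise 1 x) (suc (suc n))
  raise-good x G = record
    { head-zero = startsWithZero-raise x (Good.head-zero G)
    ; ascent-condition = ascSeqFrom-raise 1 1 0 x (λ ()) (λ _ → refl) (λ _ → s≤s z≤n)
        (Good.nonzero-monotone G) (Good.has-zero G) (Good.ascent-condition G)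
    ; nonzero-monotone = monotoneNonzero-raise 1 1 x (λ ()) (λ _ → refl)
        (Good.nonzero-monotone G) (Good.has-zero G)
    ; has-zero = raise-has-zero 1 x (Good.has-zero G)
    ; length≡ = trans (length-raise 1 x (Good.has-zero G)) (cong suc (Good.length≡ G)) }

  good-asc-raise : ∀ x → Good x (suc n) → asc (raise 1 x) ≡ suc (asc x)
  good-asc-raise x G = trans (asc-via _ (startsWithZero-raise x (Good.head-zero G)))
    (trans (ascFrom-raise 1 1 x (λ ()) (λ _ → refl) (Good.nonzero-monotone G) (Good.has-zero G))
        (cong suc (sym (asc-via x (Good.head-zero G)))))

  good-rlm-raise : ∀ x → Good x (suc n) → rlm (raise 1 x) ≡ suc (rlm x)
  good-rlm-raise x G = rlm-raise 1 1 x (λ ()) (λ _ → refl) (Good.nonzero-monotone G) (Good.has-zero G)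

  startsWithZero-lower : ∀ x' → StartsWithZero x' → monotoneNonzero 1 x' ≡ true →
      lastZeroAfterMin 1 x' ≡ false → StartsWithZero (lower 1 x')
  startsWithZero-lower .(zero ∷ ys) (ys , refl) nzb cl = lower-head ys nzb cl

  lower-good : ∀ x' → Good x' (suc (suc n)) → lastZeroAfterMin 1 x' ≡ false →
           (raise 1 (lower 1 x') ≡ x') × Good (lower 1 x') (suc n)
  lower-good x' G cl =
    raise-lower 1 1 x' (λ _ → refl) (Good.nonzero-monotone G) (Good.has-zero G) cl ,
    record
    { head-zero = startsWithZero-lower x' (Good.head-zero G) (Good.nonzero-monotone G) cl
    ; ascent-condition = ascSeqFrom-lower 1 1 0 x' (λ _ → refl) (Good.nonzero-monotone G) (Good.has-zero G) cl
        (Good.ascent-condition G)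
    ; nonzero-monotone = monotoneNonzero-lower 1 1 x' (λ _ → refl) (Good.nonzero-monotone G)
        (Good.has-zero G) cl
    ; has-zero = lower-has-zero 1 x' (Good.has-zero G) cl
    ; length≡ = suc-injective (trans (length-lower 1 x' (Good.has-zero G)) (Good.length≡ G)) }

  -- A sequence is a first-kind child iff 'lastZeroAfterMin 1' holds.
  downH : ∀ {a r'} (u : AscSet (suc (suc n)) a r') (b : Bool) → lastZeroAfterMin 1 (proj₁ u) ≡ b →
      Children AscSet n a r'
  downH {a} {r'} u@(x' , iA , len , av , ea , er) true cl =
    let G = good u in
    let D = deleteLastZero-good x' G iA cl in
    let lt = proj₁ D in
    let eq = proj₁ (proj₂ D) in
    let Gx = proj₂ (proj₂ D) in
    let x = deleteLastZero x' in
    let d = pred (rlm x') in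
    let r'eq : r' ≡ suc d
        r'eq = trans (sym er) (trans (cong rlm (sym eq)) (rlm-insertZero d x lt)) in
    inj₁ (rlm x , (subst (1 ≤_) (sym r'eq) (s≤s z≤n) , subst (_≤ rlm x) (sym r'eq) lt) ,
          fromGood x Gx (trans (sym (good-asc-insertZero x d Gx lt)) (trans (cong asc eq) ea)) refl)
  downH {a} {r'} u@(x' , iA , len , av , ea , er) false cl =
    let G = good u in
    let D = lower-good x' G cl in
    let eq = proj₁ D in
    let Gx = proj₂ D in
    let x = lower 1 x' in
    inj₂ (asc x , rlm x ,
          (trans (sym ea) (trans (cong asc (sym eq)) (good-asc-raise x Gx)) ,
           trans (sym er) (trans (cong rlm (sym eq)) (good-rlm-raise x Gx))) ,
          fromGood x Gx refl refl)

  down : ∀ {a r'} → AscSet (suc (suc n)) a r' → Children AscSet n a r'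
  down u = downH u (lastZeroAfterMin 1 (proj₁ u)) refl

  up : ∀ {a r'} → Children AscSet n a r' → AscSet (suc (suc n)) a r'
  up {a} {r'} (inj₁ (r , (h1 , h2) , u@(x , iA , len , av , ea , er))) =
    let G = good u in
    let lt = keep-parameter {ρ = rlm x} h1 h2 er in
    fromGood (insertZero (pred r') x) (insertZero-good x (pred r') G lt)
        (trans (good-asc-insertZero x (pred r') G lt) ea)
        (trans (rlm-insertZero (pred r') x lt) (suc-pred-≥1 h1))
  up {a} {r'} (inj₂ (a₀ , r₀ , (ea' , er') , u@(x , iA , len , av , ea , er))) =
    let G = good u in
    fromGood (raise 1 x) (raise-good x G) (trans (good-asc-raise x G) (trans (cong suc ea) (sym ea')))
        (trans (good-rlm-raise x G) (trans (cong suc er) (sym er')))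

  upDownH : ∀ {a r'} (u : AscSet (suc (suc n)) a r') b (e : lastZeroAfterMin 1 (proj₁ u) ≡ b) →
      up (downH u b e) ≡ u
  upDownH u@(x' , iA , len , av , ea , er) true cl =
    AscSet-≡ _ _ (trans (cong (λ z → insertZero z (deleteLastZero x')) (cong pred (sym er)))
        (proj₁ (proj₂ (deleteLastZero-good x' (good u) iA cl))))
  upDownH u@(x' , iA , len , av , ea , er) false cl =
    AscSet-≡ _ _ (proj₁ (lower-good x' (good u) cl))

  downUpH : ∀ {a r'} (k : Children AscSet n a r') b (e : lastZeroAfterMin 1 (proj₁ (up k)) ≡ b) →
      downH (up k) b e ≡ k
  downUpH {a} {r'} (inj₁ (r , (h1 , h2) , u@(x , iA , len , av , ea , er))) true e =
    let lt = keep-parameter {ρ = rlm x} h1 h2 er in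
    same-keep (trans (cong rlm (deleteLastZero-insertZero (pred r') x lt)) er)
        (deleteLastZero-insertZero (pred r') x lt)
  downUpH {a} {r'} (inj₁ (r , (h1 , h2) , u@(x , iA , len , av , ea , er))) false e =
    let lt = keep-parameter {ρ = rlm x} h1 h2 er in
    ⊥-elim (true≢false (trans (sym (lastZeroAfterMin-insertZero (pred r') x lt 1)) e))
  downUpH {a} {r'} (inj₂ (a₀ , r₀ , (ea' , er') , u@(x , iA , len , av , ea , er))) false e =
    let G = good u in
    let fi = lower-raise 1 1 x (λ ()) (λ _ → refl) (Good.nonzero-monotone G) (Good.has-zero G) in
    same-grow (trans (cong asc fi) ea) (trans (cong rlm fi) er) fi
  downUpH {a} {r'} (inj₂ (a₀ , r₀ , (ea' , er') , u@(x , iA , len , av , ea , er))) true e =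
    let G = good u in
    ⊥-elim (true≢false (trans (sym e) (lastZeroAfterMin-raise 1 1 x (λ ()) (λ _ → refl)
        (Good.nonzero-monotone G) (Good.has-zero G))))

  step : ∀ a r' → AscSet (suc (suc n)) a r' ↔ Children AscSet n a r'
  step a r' = mk↔ₛ′ down up (λ k → downUpH k _ refl) (λ u → upDownH u _ refl)

ascStep : ∀ n a r → AscSet (suc (suc n)) a r ↔ Children AscSet n a r
ascStep n = AscStep.step n

Stats₀ : ℕ → ℕ → Set
Stats₀ a r = (a ≡ 0) × (r ≡ 0)
Stats₁ : ℕ → ℕ → Set
Stats₁ a r = (a ≡ 0) × (r ≡ 1)

ascSet₀ : ∀ a r → AscSet 0 a r ↔ Stats₀ a r
ascSet₀ a r = mk↔ₛ′ to from (λ { (p , q) → cong₂ _,_ (≡-irrelevant _ _) (≡-irrelevant _ _) }) from∘to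
  where
  to : AscSet 0 a r → Stats₀ a r
  to ([] , _ , _ , _ , e1 , e2) = sym e1 , sym e2
  to ((_ ∷ _) , _ , () , _)
  from : Stats₀ a r → AscSet 0 a r
  from (refl , refl) = [] , tt , refl , tt , refl , refl
  from∘to : ∀ x → from (to x) ≡ x
  from∘to ([] , p1 , p2 , p3 , refl , refl) = AscSet-≡ _ _ refl
  from∘to ((_ ∷ _) , _ , () , _)

permSet₀ : ∀ a r → PermSet 0 a r ↔ Stats₀ a r
permSet₀ a r = mk↔ₛ′ to from (λ { (p , q) → cong₂ _,_ (≡-irrelevant _ _) (≡-irrelevant _ _) }) from∘to
  where
  to : PermSet 0 a r → Stats₀ a r
  to ([] , _ , _ , e1 , e2) = sym e1 , sym e2
  to ((_ ∷ _) , () , _)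
  from : Stats₀ a r → PermSet 0 a r
  from (refl , refl) = [] , tt , tt , refl , refl
  from∘to : ∀ x → from (to x) ≡ x
  from∘to ([] , p1 , p3 , refl , refl) = PermSet-≡ _ _ refl
  from∘to ((_ ∷ _) , () , _)

ascSet₁ : ∀ a r → AscSet 1 a r ↔ Stats₁ a r
ascSet₁ a r = mk↔ₛ′ to from (λ { (p , q) → cong₂ _,_ (≡-irrelevant _ _) (≡-irrelevant _ _) }) from∘to
  where
  to : AscSet 1 a r → Stats₁ a r
  to ((zero ∷ []) , _ , _ , _ , e1 , e2) = sym e1 , sym e2
  to ((suc _ ∷ []) , () , _)
  to ([] , _ , () , _)
  to ((_ ∷ _ ∷ _) , _ , () , _)
  from : Stats₁ a r → AscSet 1 a r
  from (refl , refl) = (0 ∷ []) , tt , refl , tt , refl , refl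
  from∘to : ∀ x → from (to x) ≡ x
  from∘to ((zero ∷ []) , p1 , p2 , p3 , refl , refl) = AscSet-≡ _ _ refl
  from∘to ((suc _ ∷ []) , () , _)
  from∘to ([] , _ , () , _)
  from∘to ((_ ∷ _ ∷ _) , _ , () , _)

permSet₁ : ∀ a r → PermSet 1 a r ↔ Stats₁ a r
permSet₁ a r = mk↔ₛ′ to from (λ { (p , q) → cong₂ _,_ (≡-irrelevant _ _) (≡-irrelevant _ _) }) from∘to
  where
  to : PermSet 1 a r → Stats₁ a r
  to ((suc zero ∷ []) , _ , _ , e1 , e2) = sym e1 , sym e2
  to ((zero ∷ []) , () , _)
  to ((suc (suc _) ∷ []) , () , _)
  to ([] , () , _)
  to ((_ ∷ _ ∷ _) , () , _)
  from : Stats₁ a r → PermSet 1 a r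
  from (refl , refl) = (1 ∷ []) , tt , tt , refl , refl
  from∘to : ∀ x → from (to x) ≡ x
  from∘to ((suc zero ∷ []) , p1 , p3 , refl , refl) = PermSet-≡ _ _ refl
  from∘to ((zero ∷ []) , () , _)
  from∘to ((suc (suc _) ∷ []) , () , _)
  from∘to ([] , () , _)
  from∘to ((_ ∷ _ ∷ _) , () , _)

mainTheorem1 : (n a r : ℕ) → AscSet n a r ⤖ PermSet n a r
mainTheorem1 n a r = ↔⇒⤖ (equinumerous-by-recursion AscSet PermSet
  (λ a r → ↔-trans (ascSet₀ a r) (↔-sym (permSet₀ a r)))
  (λ a r → ↔-trans (ascSet₁ a r) (↔-sym (permSet₁ a r)))
  ascStep permStep n a r)
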